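{- Let $G$, $M$, $C_1,\dots,C_l$ be as in the context, let $i\in\{1,\dots,l\}$, let $x\in\partial(C_i)$ and $A_2=\partial(C_i)\setminus\{x\}$. Then $C_i$ has an $(\emptyset,\emptyset,\{x\},A_2)$-decomposition.
   Context: All graphs are finite and simple. Standing assumption: $G$ is a star-like cubic graph with perfect matching $M$ (i.e. $G$ is connected, cubic, and contracting each cycle of $G-M$ to a vertex, joining two such vertices when an edge of $M$ connects the corresponding cycles, yields a star), and $C_1,\dots,C_l$ are the cycles of $G-M$. A decomposition of a graph is a set of subgraphs such that every edge lies in exactly one of them. $G_i=G[V(C_i)]$ and $\partial(C_i)$ is the set of vertices of degree $2$ in $G_i$. A path component is a component that is a path with at least one edge; a leaf of a forest is a vertex of degree $1$ in it. Given pairwise disjoint sets $A_0,A_p,A_m,A_2$ with union $\partial(C_i)$, an $(A_0,A_p,A_m,A_2)$-decomposition of $C_i$ is a decomposition $\{F_i,\mathcal{C}_i,(V(C_i),M_i)\}$ of $G_i$ where $F_i$ is a spanning forest of $G_i$, $\mathcal{C}_i$ is a spanning subgraph of $G_i$ of maximum degree $2$, $M_i$ is a matching, and (i) for every component $K$ of $F_i$, the set $V(K)\cap(A_2\cup A_m)$ is nonempty and contains at most one vertex that is a leaf of $F_i$ or lies in $A_m$; (ii) the set of ends of path components of $\mathcal{C}_i$ is exactly $A_p$. -}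

module Defs where

open import Data.Nat using (ℕ; _+_; _≤_)
open import Data.Bool using (Bool; true; false; _∧_; not)
open import Data.Fin using (Fin)
open import Data.List using (List; _∷_; _++_; _∷ʳ_; length; map; allFin)
open import Data.Nat.ListAction using (sum)
open import Data.List.Membership.Propositional using (_∈_)
open import Data.List.Relation.Unary.Unique.Propositional using (Unique)
open import Data.List.Relation.Unary.Linked using (Linked)
open import Data.Product using (Σ; ∃; ∃₂; _×_; _,_)
open import Data.Sum using (_⊎_)
open import Function.Bundles using (_⇔_)
open import Relation.Binary.PropositionalEquality using (_≡_)
open import Relation.Nullary using (¬_)

-- A (Bool-valued) edge relation on the vertex set Fin n.
-- Graphs, subgraphs, matchings and edge sets are all represented this way.
ERel : ℕ → Set
ERel n = Fin n → Fin n → Bool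

VSet : ℕ → Set
VSet n = Fin n → Bool

b2n : Bool → ℕ
b2n true  = 1
b2n false = 0

module _ {n : ℕ} where

  deg : ERel n → Fin n → ℕ
  deg E v = sum (map (λ w → b2n (E v w)) (allFin n))

  SymmetricE : ERel n → Set
  SymmetricE E = ∀ u v → E u v ≡ E v u

  IrreflexiveE : ERel n → Set
  IrreflexiveE E = ∀ v → E v v ≡ false

  _⊆ᴱ_ : ERel n → ERel n → Set
  E ⊆ᴱ H = ∀ u v → E u v ≡ true → H u v ≡ true

  _∖ᴱ_ : ERel n → ERel n → ERel n
  (G ∖ᴱ M) u v = G u v ∧ not (M u v)

  Induced : ERel n → VSet n → ERel n
  Induced G S u v = S u ∧ (S v ∧ G u v)

  data Reach (E : ERel n) : Fin n → Fin n → Set where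
    here : ∀ {v} → Reach E v v
    step : ∀ {u w v} → E u w ≡ true → Reach E w v → Reach E u v

  Connected : ERel n → Set
  Connected E = ∀ u v → Reach E u v

  IsComponentOf : ERel n → Fin n → VSet n → Set
  IsComponentOf E c S = ∀ v → (S v ≡ true) ⇔ Reach E c v

  IsPerfectMatching : ERel n → ERel n → Set
  IsPerfectMatching G M = SymmetricE M × (M ⊆ᴱ G) × (∀ v → deg M v ≡ 1)

  -- In the graph obtained by contracting the components (cycles) of G - M,
  -- the components of u and v are joined (by an edge of M).
  ContrAdj : ERel n → ERel n → Fin n → Fin n → Set
  ContrAdj G M u v =
    ∃₂ λ a b → Reach (G ∖ᴱ M) u a × Reach (G ∖ᴱ M) v b × (M a b ≡ true)

  -- The contracted graph is a star: there is a centre component (that of z)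
  -- such that two distinct contracted vertices are adjacent iff one of them
  -- is the centre.
  ContractionIsStar : ERel n → ERel n → Set
  ContractionIsStar G M =
    ∃ λ z → ∀ u v → ¬ Reach (G ∖ᴱ M) u v →
      (ContrAdj G M u v ⇔ (Reach (G ∖ᴱ M) z u ⊎ Reach (G ∖ᴱ M) z v))

  record IsStarLike (G M : ERel n) : Set where
    field
      sym       : SymmetricE G
      irrefl    : IrreflexiveE G
      connected : Connected G
      cubic     : ∀ v → deg G v ≡ 3
      perfect   : IsPerfectMatching G M
      star      : ContractionIsStar G M

  Boundary : ERel n → VSet n → Fin n → Set
  Boundary G S v = (S v ≡ true) × (deg (Induced G S) v ≡ 2)

  -- no cycle: no list of ≥ 3 distinct vertices a, r₁, …, r_k with
  -- a r₁ … r_k a a closed walk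
  Acyclic : ERel n → Set
  Acyclic E = ∀ a rest → Unique (a ∷ rest) → 2 ≤ length rest →
              ¬ Linked (λ x y → E x y ≡ true) ((a ∷ rest) ∷ʳ a)

  Leaf : ERel n → Fin n → Set
  Leaf E v = deg E v ≡ 1

  Consec : List (Fin n) → Fin n → Fin n → Set
  Consec ws a b = ∃₂ λ ys zs → ws ≡ ys ++ (a ∷ b ∷ zs)

  -- the component of E containing v is a path with at least one edge,
  -- whose vertices in order are ws
  PathComp : ERel n → Fin n → List (Fin n) → Set
  PathComp E v ws =
    Unique ws × 2 ≤ length ws ×
    (∀ u → (u ∈ ws) ⇔ Reach E v u) ×
    (∀ a b → a ∈ ws → b ∈ ws → ((E a b ≡ true) ⇔ (Consec ws a b ⊎ Consec ws b a)))

  IsPathEnd : ERel n → Fin n → Set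
  IsPathEnd E w = ∃ λ rest → PathComp E w (w ∷ rest) ⊎ PathComp E w (rest ∷ʳ w)

  -- (A0,Ap,Am,A2)-decomposition of the cycle C with vertex set S in G:
  -- a decomposition {F, 𝒞, (V(C),Mi)} of G[S].
  record Decomposition (G : ERel n) (S : VSet n) (A0 Ap Am A2 : Fin n → Set) : Set where
    field
      F 𝒞 Mi   : ERel n
      F-sym    : SymmetricE F
      𝒞-sym    : SymmetricE 𝒞
      Mi-sym   : SymmetricE Mi
      F-sub    : F ⊆ᴱ Induced G S
      𝒞-sub    : 𝒞 ⊆ᴱ Induced G S
      Mi-sub   : Mi ⊆ᴱ Induced G S
      cover    : ∀ u v → Induced G S u v ≡ true →
                 b2n (F u v) + b2n (𝒞 u v) + b2n (Mi u v) ≡ 1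
      forest   : Acyclic F
      maxdeg2  : ∀ v → deg 𝒞 v ≤ 2
      matching : ∀ v → deg Mi v ≤ 1
      -- (i) for each component K of F (the one containing v ∈ S)
      cond-i-nonempty : ∀ v → S v ≡ true →
                 ∃ λ w → Reach F v w × (A2 w ⊎ Am w)
      cond-i-atmostone : ∀ v → S v ≡ true → ∀ w₁ w₂ →
                 Reach F v w₁ → Reach F v w₂ →
                 (A2 w₁ ⊎ Am w₁) → (A2 w₂ ⊎ Am w₂) →
                 (Leaf F w₁ ⊎ Am w₁) → (Leaf F w₂ ⊎ Am w₂) → w₁ ≡ w₂
      cond-ii  : ∀ w → IsPathEnd 𝒞 w ⇔ Ap w

module Submission where

-- G − M is 2-regular, so the component of x is a cycle x = w₀, w₁, …, w_{k−1}; a vertex of it is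
-- a boundary vertex exactly when its M-partner lies off the cycle, otherwise the two are joined by
-- a chord. Without chords, take 𝒞 = G[C] and F, Mᵢ empty. Otherwise pick a chord w_a w_b with
-- 0 < a < b and b − a minimal. Then 𝒞 is the cycle w_a … w_b w_a, Mᵢ consists of the chords with
-- both ends off the arc w_a … w_b, and F of the remaining edges. By minimality the partner of an
-- interior arc vertex is off the arc, so F is a tree through x (the two stretches of the cycle
-- from x to the arc, with interior arc vertices hanging from their partners) plus isolated
-- interior boundary vertices, and no boundary vertex is a leaf of it.

open import Algebra.Properties.CommutativeSemigroup using (interchange)
open import Data.Bool using (Bool; true; false; _∧_; _∨_; not)
open import Data.Bool.Properties using (∧-comm; ∧-zeroʳ; ∧-identityʳ; ∨-zeroʳ; ¬-not) renaming (_≟_ to _≟ᵇ_)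
open import Data.Empty using (⊥; ⊥-elim)
open import Data.Fin using (Fin; zero; suc; _≟_; toℕ; fromℕ<)
import Data.Fin.Properties as Fin
open import Data.List using (List; []; _∷_; _++_; _∷ʳ_; length; tabulate)
open import Data.List.Membership.Propositional using (_∈_)
open import Data.List.Membership.Propositional.Properties using (∈-++⁺ʳ)
open import Data.List.Properties using (map-tabulate; ∷-injectiveˡ; ∷-injectiveʳ)
open import Data.List.Relation.Unary.All as All using (All)
open import Data.List.Relation.Unary.All.Properties using (All¬⇒¬Any)
open import Data.List.Relation.Unary.AllPairs using (_∷_)
open import Data.List.Relation.Unary.Any using (here; there)
open import Data.List.Relation.Unary.Linked using (Linked; _∷_)
open import Data.List.Relation.Unary.Unique.Propositional using (Unique)
open import Data.Nat using (ℕ; zero; suc; _+_; _∸_; _≤_; _<_; z≤n; s≤s; _≤?_; _<?_)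
open import Data.Nat.ListAction using (sum)
open import Data.Nat.Properties
  using (+-cancelʳ-≡; +-cancelˡ-<; +-comm; +-commutativeSemigroup; +-identityʳ; +-mono-≤; +-monoʳ-≤;
         +-monoˡ-<; +-suc; <-asym; <-cmp; <-irrefl; <-trans; <-≤-trans; <⇒≢; <⇒≤; m+[n∸m]≡n; m+n∸n≡m;
         m∸n≤m; m≤m+n; m≤n⇒m<n∨m≡n; m≤n⇒m≤1+n; n<1+n; n≢0⇒n>0; n≤1+n; suc-injective; ∸-monoʳ-<;
         ≤-<-trans; ≤-antisym; ≤-pred; ≤-refl; ≤-reflexive; ≤-trans; ≰⇒>)
open import Data.Product using (Σ; _×_; _,_; proj₁; proj₂)
open import Data.Sum using (_⊎_; inj₁; inj₂; [_,_]′; swap)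
open import Data.Unit using (⊤; tt)
open import Function using (_∘_; _∘′_; id)
open import Function.Bundles using (Equivalence; mk⇔)
open import Relation.Binary.Definitions using (tri<; tri≈; tri>)
open import Relation.Binary.PropositionalEquality
open import Relation.Nullary using (¬_; yes; no; Dec; does)
open import Relation.Nullary.Decidable using (_×-dec_; dec-true; dec-false; does-⇔)
open import Relation.Unary using (Decidable)

open import Defs

module Counting where

  count : (m : ℕ) → (Fin m → Bool) → ℕ
  count zero    f = 0
  count (suc m) f = b2n (f zero) + count m (f ∘ suc)

  deg≡count : ∀ {n} (E : ERel n) v → deg E v ≡ count n (E v)
  deg≡count {n} E v = trans (cong sum (map-tabulate id (λ w → b2n (E v w)))) (sum-tabulate n (E v))
    where
    sum-tabulate : ∀ m (f : Fin m → Bool) → sum (tabulate (b2n ∘ f)) ≡ count m f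
    sum-tabulate zero    f = refl
    sum-tabulate (suc m) f = cong (b2n (f zero) +_) (sum-tabulate m (f ∘ suc))

  _≡ᵇ_ : ∀ {m} → Fin m → Fin m → Bool
  i ≡ᵇ j = does (i ≟ j)

  ≡ᵇ-refl : ∀ {m} (i : Fin m) → (i ≡ᵇ i) ≡ true
  ≡ᵇ-refl i = dec-true (i ≟ i) refl

  ≢⇒≡ᵇ-false : ∀ {m} {i j : Fin m} → i ≢ j → (i ≡ᵇ j) ≡ false
  ≢⇒≡ᵇ-false {i = i} {j} = dec-false (i ≟ j)

  ≡ᵇ-suc : ∀ {m} (i j : Fin m) → (suc i ≡ᵇ suc j) ≡ (i ≡ᵇ j)
  ≡ᵇ-suc i j = does-⇔ (mk⇔ Fin.suc-injective (cong suc)) (suc i ≟ suc j) (i ≟ j)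

  count-cong : ∀ m {f g : Fin m → Bool} → (∀ i → f i ≡ g i) → count m f ≡ count m g
  count-cong zero    f≗g = refl
  count-cong (suc m) f≗g = cong₂ _+_ (cong b2n (f≗g zero)) (count-cong m (f≗g ∘ suc))

  count-mono : ∀ m {f g : Fin m → Bool} → (∀ i → f i ≡ true → g i ≡ true) → count m f ≤ count m g
  count-mono zero    f⇒g = z≤n
  count-mono (suc m) f⇒g = +-mono-≤ (b2n-mono (f⇒g zero)) (count-mono m (f⇒g ∘ suc))
    where
    b2n-mono : ∀ {a b} → (a ≡ true → b ≡ true) → b2n a ≤ b2n b
    b2n-mono {false} _   = z≤n
    b2n-mono {true}  a⇒b rewrite a⇒b refl = ≤-refl

  count-+ : ∀ m (f g h : Fin m → Bool) → (∀ i → b2n (f i) + b2n (g i) ≡ b2n (h i)) →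
            count m f + count m g ≡ count m h
  count-+ zero    f g h f+g≗h = refl
  count-+ (suc m) f g h f+g≗h =
    trans (interchange +-commutativeSemigroup (b2n (f zero)) (count m (f ∘ suc)) (b2n (g zero)) (count m (g ∘ suc)))
          (cong₂ _+_ (f+g≗h zero) (count-+ m (f ∘ suc) (g ∘ suc) (h ∘ suc) (f+g≗h ∘ suc)))

  count-none : ∀ m {f : Fin m → Bool} → (∀ i → f i ≡ false) → count m f ≡ 0
  count-none zero    _    = refl
  count-none (suc m) none rewrite none zero = count-none m (none ∘ suc)

  count≡0⇒none : ∀ m {f : Fin m → Bool} → count m f ≡ 0 → ∀ i → f i ≡ false
  count≡0⇒none (suc m) {f} c≡0 i with f zero in f0
  count≡0⇒none (suc m) c≡0 zero    | false = f0
  count≡0⇒none (suc m) c≡0 (suc i) | false = count≡0⇒none m c≡0 i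

  count-∨ : ∀ m (f g : Fin m → Bool) → count m (λ i → f i ∨ g i) ≤ count m f + count m g
  count-∨ zero    f g = z≤n
  count-∨ (suc m) f g =
    ≤-trans (+-mono-≤ (b2n-∨ (f zero) (g zero)) (count-∨ m (f ∘ suc) (g ∘ suc)))
            (≤-reflexive (interchange +-commutativeSemigroup (b2n (f zero)) (b2n (g zero)) (count m (f ∘ suc)) (count m (g ∘ suc))))
    where
    b2n-∨ : ∀ a b → b2n (a ∨ b) ≤ b2n a + b2n b
    b2n-∨ false b = ≤-refl
    b2n-∨ true  b = s≤s z≤n

  count-singleton : ∀ m (p : Fin m) → count m (_≡ᵇ p) ≡ 1
  count-singleton (suc m) zero    = cong suc (count-none m (λ _ → refl))
  count-singleton (suc m) (suc p) = trans (count-cong m (λ i → ≡ᵇ-suc i p)) (count-singleton m p)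

  count≤1 : ∀ m {f : Fin m → Bool} (p : Fin m) → (∀ i → f i ≡ true → i ≡ p) → count m f ≤ 1
  count≤1 m p only-p =
    ≤-trans (count-mono m (λ i fi → subst (λ z → (z ≡ᵇ p) ≡ true) (sym (only-p i fi)) (≡ᵇ-refl p)))
            (≤-reflexive (count-singleton m p))

  count≤2 : ∀ m {f : Fin m → Bool} (p q : Fin m) → (∀ i → f i ≡ true → i ≡ p ⊎ i ≡ q) → count m f ≤ 2
  count≤2 m {f} p q only-pq =
    ≤-trans (count-mono m {g = λ i → (i ≡ᵇ p) ∨ (i ≡ᵇ q)} hit)
      (≤-trans (count-∨ m (_≡ᵇ p) (_≡ᵇ q)) (≤-reflexive (cong₂ _+_ (count-singleton m p) (count-singleton m q))))
    where
    hit : ∀ i → f i ≡ true → ((i ≡ᵇ p) ∨ (i ≡ᵇ q)) ≡ true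
    hit i fi with only-pq i fi
    ... | inj₁ refl rewrite ≡ᵇ-refl p = refl
    ... | inj₂ refl rewrite ≡ᵇ-refl q = ∨-zeroʳ (q ≡ᵇ p)

  _without_ : ∀ {m} → (Fin m → Bool) → Fin m → Fin m → Bool
  (f without p) i = f i ∧ not (i ≡ᵇ p)

  without-keeps : ∀ {m} {f : Fin m → Bool} {p i} → i ≢ p → f i ≡ true → (f without p) i ≡ true
  without-keeps i≢p fi rewrite fi | ≢⇒≡ᵇ-false i≢p = refl

  without-true : ∀ {m} {f : Fin m → Bool} {p i} → (f without p) i ≡ true → f i ≡ true × i ≢ p
  without-true {f = f} {p} {i} e with f i | i ≟ p
  without-true () | false | _
  without-true () | true  | yes _
  ... | true | no i≢p = refl , i≢p

  count-without : ∀ m {f : Fin m → Bool} (p : Fin m) → f p ≡ true → count m f ≡ suc (count m (f without p))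
  count-without (suc m) {f} zero fp rewrite fp = cong suc (count-cong m (λ i → sym (∧-identityʳ (f (suc i)))))
  count-without (suc m) {f} (suc p) fp rewrite ∧-identityʳ (f zero) =
    trans (cong (b2n (f zero) +_) (trans (count-without m p fp) (cong suc (count-cong m drop-suc))))
          (+-suc (b2n (f zero)) _)
    where
    drop-suc : ∀ i → f (suc i) ∧ not (i ≡ᵇ p) ≡ f (suc i) ∧ not (suc i ≡ᵇ suc p)
    drop-suc i = cong (λ z → f (suc i) ∧ not z) (sym (≡ᵇ-suc i p))

  1≤count : ∀ m {f : Fin m → Bool} p → f p ≡ true → 1 ≤ count m f
  1≤count m p fp = subst (1 ≤_) (sym (count-without m p fp)) (s≤s z≤n)

  2≤count : ∀ m {f : Fin m → Bool} p q → p ≢ q → f p ≡ true → f q ≡ true → 2 ≤ count m f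
  2≤count m {f} p q p≢q fp fq =
    subst (2 ≤_) (sym (count-without m p fp)) (s≤s (1≤count m q (without-keeps {f = f} (p≢q ∘ sym) fq)))

  3≤count : ∀ m {f : Fin m → Bool} p q r → p ≢ q → p ≢ r → q ≢ r →
            f p ≡ true → f q ≡ true → f r ≡ true → 3 ≤ count m f
  3≤count m {f} p q r p≢q p≢r q≢r fp fq fr =
    subst (3 ≤_) (sym (count-without m p fp))
      (s≤s (2≤count m q r q≢r (without-keeps {f = f} (p≢q ∘ sym) fq) (without-keeps {f = f} (p≢r ∘ sym) fr)))

  count-witness : ∀ m {f : Fin m → Bool} → 1 ≤ count m f → Σ (Fin m) λ p → f p ≡ true
  count-witness (suc m) {f} pos with f zero in f0
  ... | true  = zero , f0
  ... | false with count-witness m {f ∘ suc} pos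
  ... | p , fp = suc p , fp

  count≡1⇒unique : ∀ m {f : Fin m → Bool} → count m f ≡ 1 →
                   Σ (Fin m) λ p → f p ≡ true × (∀ i → f i ≡ true → i ≡ p)
  count≡1⇒unique m {f} c≡1 with count-witness m (≤-reflexive (sym c≡1))
  ... | p , fp = p , fp , only-p
    where
    only-p : ∀ i → f i ≡ true → i ≡ p
    only-p i fi with i ≟ p
    ... | yes i≡p = i≡p
    ... | no i≢p with trans (sym (without-keeps {f = f} i≢p fi))
                            (count≡0⇒none m (suc-injective (trans (sym (count-without m p fp)) c≡1)) i)
    ... | ()

  count≡2⇒pair : ∀ m {f : Fin m → Bool} → count m f ≡ 2 →
                 Σ (Fin m) λ p → Σ (Fin m) λ q → p ≢ q × f p ≡ true × f q ≡ true ×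
                 (∀ i → f i ≡ true → i ≡ p ⊎ i ≡ q)
  count≡2⇒pair m {f} c≡2 with count-witness m (≤-trans (s≤s z≤n) (≤-reflexive (sym c≡2)))
  ... | p , fp with count≡1⇒unique m (suc-injective (trans (sym (count-without m p fp)) c≡2))
  ... | q , f∖p[q] , only-q with without-true {f = f} f∖p[q]
  ... | fq , q≢p = p , q , (q≢p ∘ sym) , fp , fq , only-pq
    where
    only-pq : ∀ i → f i ≡ true → i ≡ p ⊎ i ≡ q
    only-pq i fi with i ≟ p
    ... | yes i≡p = inj₁ i≡p
    ... | no i≢p  = inj₂ (only-q i (without-keeps {f = f} i≢p fi))

module UniqueLists {A : Set} where

  head-has-no-predecessor : ∀ {w p : A} {rest} ys zs → Unique (w ∷ rest) → w ∷ rest ≢ ys ++ p ∷ w ∷ zs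
  head-has-no-predecessor {w} []       zs (w∉ ∷ _) e =
    All¬⇒¬Any w∉ (subst (w ∈_) (sym (∷-injectiveʳ e)) (here refl))
  head-has-no-predecessor {w} (y ∷ ys) zs (w∉ ∷ _) e =
    All¬⇒¬Any w∉ (subst (w ∈_) (sym (∷-injectiveʳ e)) (∈-++⁺ʳ ys (there (here refl))))

  last-has-no-successor : ∀ {w p : A} rest ys zs → Unique (rest ∷ʳ w) → rest ∷ʳ w ≢ ys ++ w ∷ p ∷ zs
  last-has-no-successor []       []            zs _ ()
  last-has-no-successor []       (_ ∷ [])      zs _ ()
  last-has-no-successor []       (_ ∷ _ ∷ _)   zs _ ()
  last-has-no-successor {w} (r ∷ rest) [] zs (r∉ ∷ _) e =
    All¬⇒¬Any r∉ (subst (_∈ (rest ∷ʳ w)) (sym (∷-injectiveˡ e)) (∈-++⁺ʳ rest (here refl)))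
  last-has-no-successor (r ∷ rest) (y ∷ ys) zs (_ ∷ u) e = last-has-no-successor rest ys zs u (∷-injectiveʳ e)

  successor-unique : ∀ {w p q : A} ws ys zs ys′ zs′ → Unique ws →
                     ws ≡ ys ++ w ∷ p ∷ zs → ws ≡ ys′ ++ w ∷ q ∷ zs′ → p ≡ q
  successor-unique ws [] zs [] zs′ _ e e′ = ∷-injectiveˡ (∷-injectiveʳ (trans (sym e) e′))
  successor-unique {w} _ [] zs (y ∷ ys′) zs′ (w∉ ∷ _) refl e′ =
    ⊥-elim (All¬⇒¬Any w∉ (subst (w ∈_) (sym (∷-injectiveʳ e′)) (∈-++⁺ʳ ys′ (here refl))))
  successor-unique {w} {p} _ (y ∷ ys) zs [] zs′ (y∉ ∷ _) refl e′ =
    ⊥-elim (All¬⇒¬Any y∉ (subst (_∈ (ys ++ w ∷ p ∷ zs)) (sym (∷-injectiveˡ e′)) (∈-++⁺ʳ ys (here refl))))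
  successor-unique _ (y ∷ ys) zs (_ ∷ ys′) zs′ (_ ∷ u) refl e′ =
    successor-unique _ ys zs ys′ zs′ u refl (∷-injectiveʳ e′)

  predecessor-unique : ∀ {w p q : A} ws ys zs ys′ zs′ → Unique ws →
                       ws ≡ ys ++ p ∷ w ∷ zs → ws ≡ ys′ ++ q ∷ w ∷ zs′ → p ≡ q
  predecessor-unique ws [] zs [] zs′ _ e e′ = ∷-injectiveˡ (trans (sym e) e′)
  predecessor-unique _ [] zs (_ ∷ ys′) zs′ (_ ∷ u) refl e′ =
    ⊥-elim (head-has-no-predecessor ys′ zs′ u (∷-injectiveʳ e′))
  predecessor-unique _ (_ ∷ ys) zs [] zs′ (_ ∷ u) refl e′ =
    ⊥-elim (head-has-no-predecessor ys zs (subst Unique (∷-injectiveʳ e′) u) (sym (∷-injectiveʳ e′)))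
  predecessor-unique _ (_ ∷ ys) zs (_ ∷ ys′) zs′ (_ ∷ u) refl e′ =
    predecessor-unique _ ys zs ys′ zs′ u refl (∷-injectiveʳ e′)

module Reachability {n : ℕ} {E : ERel n} where

  reach-trans : ∀ {u v w} → Reach E u v → Reach E v w → Reach E u w
  reach-trans here       r′ = r′
  reach-trans (step e r) r′ = step e (reach-trans r r′)

  reach-snoc : ∀ {u v w} → Reach E u v → E v w ≡ true → Reach E u w
  reach-snoc r e = reach-trans r (step e here)

  reach-sym : SymmetricE E → ∀ {u v} → Reach E u v → Reach E v u
  reach-sym E-sym here                 = here
  reach-sym E-sym (step {u} {w} e r) = reach-snoc (reach-sym E-sym r) (trans (E-sym w u) e)

  reach-from-isolated : ∀ {w u} → (∀ v → E w v ≡ false) → Reach E w u → w ≡ u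
  reach-from-isolated isolated here = refl
  reach-from-isolated isolated (step {w = v} e _) with trans (sym (isolated v)) e
  ... | ()

module PathEnds {n : ℕ} (E : ERel n) where

  open UniqueLists
  open Reachability

  isolated⇒¬IsPathEnd : ∀ {w} → (∀ v → E w v ≡ false) → ¬ IsPathEnd E w
  isolated⇒¬IsPathEnd isolated ([] , inj₁ (_ , s≤s () , _))
  isolated⇒¬IsPathEnd isolated ([] , inj₂ (_ , s≤s () , _))
  isolated⇒¬IsPathEnd isolated (r ∷ t , inj₁ (w∉ ∷ _ , _ , members , _)) =
    All.lookup w∉ (here refl) (reach-from-isolated isolated (Equivalence.to (members r) (there (here refl))))
  isolated⇒¬IsPathEnd isolated (r ∷ t , inj₂ (r∉ ∷ _ , _ , members , _)) =
    All.lookup r∉ (∈-++⁺ʳ t (here refl))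
      (sym (reach-from-isolated isolated (Equivalence.to (members r) (here refl))))

  two-neighbours⇒¬IsPathEnd : ∀ {w p q} → p ≢ q → E w p ≡ true → E w q ≡ true → ¬ IsPathEnd E w
  two-neighbours⇒¬IsPathEnd {w} {p} {q} p≢q Ewp Ewq (rest , inj₁ (u , _ , members , adjacent))
    with Equivalence.to (adjacent w p (here refl) (Equivalence.from (members p) (step Ewp here))) Ewp
       | Equivalence.to (adjacent w q (here refl) (Equivalence.from (members q) (step Ewq here))) Ewq
  ... | inj₁ (ys , zs , e) | inj₁ (ys′ , zs′ , e′) =
    p≢q (successor-unique _ ys zs ys′ zs′ u e e′)
  ... | inj₂ (ys , zs , e) | _                     = head-has-no-predecessor ys zs u e
  ... | inj₁ _             | inj₂ (ys , zs , e)    = head-has-no-predecessor ys zs u e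
  two-neighbours⇒¬IsPathEnd {w} {p} {q} p≢q Ewp Ewq (rest , inj₂ (u , _ , members , adjacent))
    with Equivalence.to (adjacent w p w∈ (Equivalence.from (members p) (step Ewp here))) Ewp
       | Equivalence.to (adjacent w q w∈ (Equivalence.from (members q) (step Ewq here))) Ewq
    where w∈ = Equivalence.from (members w) here
  ... | inj₂ (ys , zs , e) | inj₂ (ys′ , zs′ , e′) =
    p≢q (predecessor-unique _ ys zs ys′ zs′ u e e′)
  ... | inj₁ (ys , zs , e) | _                     = last-has-no-successor rest ys zs u e
  ... | inj₂ _             | inj₁ (ys , zs , e)    = last-has-no-successor rest ys zs u e

module RankedAcyclicity {A : Set} (R : A → A → Set) (R-sym : ∀ {u v} → R u v → R v u) (rank : A → ℕ)
  (rank-≢ : ∀ {u v} → R u v → rank u ≢ rank v)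
  (lower-unique : ∀ {u v v′} → R u v → R u v′ → rank v < rank u → rank v′ < rank u → v ≡ v′) where

  private
    NonBacktracking : List A → Set
    NonBacktracking (x ∷ y ∷ z ∷ t) = x ≢ z × NonBacktracking (y ∷ z ∷ t)
    NonBacktracking _               = ⊤

    last : A → List A → A
    last y []      = y
    last y (z ∷ t) = last z t

    penultimate : A → A → List A → A
    penultimate x y []      = x
    penultimate x y (z ∷ t) = penultimate y z t

    <-or-> : ∀ {u v} → R u v → rank u < rank v ⊎ rank v < rank u
    <-or-> {u} {v} Ruv with <-cmp (rank u) (rank v)
    ... | tri< lt _ _ = inj₁ lt
    ... | tri≈ _ eq _ = ⊥-elim (rank-≢ Ruv eq)
    ... | tri> _ _ gt = inj₂ gt

    keeps-rising : ∀ {x y z} → R x y → R y z → x ≢ z → rank x < rank y → rank y < rank z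
    keeps-rising Rxy Ryz x≢z up with <-or-> Ryz
    ... | inj₁ up′  = up′
    ... | inj₂ down = ⊥-elim (x≢z (lower-unique (R-sym Rxy) Ryz up down))

    fell-before : ∀ {x y z} → R x y → R y z → x ≢ z → rank z < rank y → rank y < rank x
    fell-before Rxy Ryz x≢z down with <-or-> (R-sym Rxy)
    ... | inj₁ down′ = down′
    ... | inj₂ up    = ⊥-elim (x≢z (lower-unique (R-sym Rxy) Ryz up down))

    rises-to-last : ∀ x y t → Linked R (x ∷ y ∷ t) → NonBacktracking (x ∷ y ∷ t) →
                    rank x < rank y → rank x < rank (last y t)
    rises-to-last x y []      _                      _          up = up
    rises-to-last x y (z ∷ t) (Rxy ∷ l@(Ryz ∷ _)) (x≢z , nb) up =
      <-trans up (rises-to-last y z t l nb (keeps-rising Rxy Ryz x≢z up))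

    falls-from-first : ∀ x y t → Linked R (x ∷ y ∷ t) → NonBacktracking (x ∷ y ∷ t) →
                       rank (last y t) < rank (penultimate x y t) → rank (last y t) < rank x
    falls-from-first x y t l nb down = proj₂ (falls x y t l nb down)
      where
      falls : ∀ x y t → Linked R (x ∷ y ∷ t) → NonBacktracking (x ∷ y ∷ t) →
              rank (last y t) < rank (penultimate x y t) → rank y < rank x × rank (last y t) < rank x
      falls x y []      _                      _          down = down , down
      falls x y (z ∷ t) (Rxy ∷ l@(Ryz ∷ _)) (x≢z , nb) down with falls y z t l nb down
      ... | z<y , end<y = let y<x = fell-before Rxy Ryz x≢z z<y in y<x , <-trans end<y y<x

    last-step : ∀ x y t → Linked R (x ∷ y ∷ t) → R (penultimate x y t) (last y t)
    last-step x y []      (Rxy ∷ _) = Rxy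
    last-step x y (z ∷ t) (_ ∷ l)   = last-step y z t l

    last-∷ʳ : ∀ y t z → last y (t ∷ʳ z) ≡ z
    last-∷ʳ y []      z = refl
    last-∷ʳ y (w ∷ t) z = last-∷ʳ w t z

    penultimate-∷ʳ : ∀ x y t z → penultimate x y (t ∷ʳ z) ≡ last y t
    penultimate-∷ʳ x y []      z = refl
    penultimate-∷ʳ x y (w ∷ t) z = penultimate-∷ʳ y w t z

    nonBacktracking-∷ʳ : ∀ x y t z → NonBacktracking (x ∷ y ∷ t) → penultimate x y t ≢ z →
                         NonBacktracking (x ∷ y ∷ (t ∷ʳ z))
    nonBacktracking-∷ʳ x y []      z _          ne = ne , tt
    nonBacktracking-∷ʳ x y (w ∷ t) z (x≢w , nb) ne = x≢w , nonBacktracking-∷ʳ y w t z nb ne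

    unique⇒nonBacktracking : ∀ l → Unique l → NonBacktracking l
    unique⇒nonBacktracking (x ∷ y ∷ z ∷ t) ((_ All.∷ (x≢z All.∷ _)) ∷ u) = x≢z , unique⇒nonBacktracking (y ∷ z ∷ t) u
    unique⇒nonBacktracking []              _ = tt
    unique⇒nonBacktracking (_ ∷ [])        _ = tt
    unique⇒nonBacktracking (_ ∷ _ ∷ [])    _ = tt

    penultimate-∈ : ∀ x y w t → penultimate x y (w ∷ t) ∈ (y ∷ w ∷ t)
    penultimate-∈ x y w []       = here refl
    penultimate-∈ x y w (w′ ∷ t) = there (penultimate-∈ y w w′ t)

    last-∈ : ∀ w t → last w t ∈ (w ∷ t)
    last-∈ w []       = here refl
    last-∈ w (w′ ∷ t) = there (last-∈ w′ t)

  -- Since a vertex has at most one lower neighbour, along a non-backtracking walk the rank keeps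
  -- rising once it rises; so a cycle through a can neither leave a upwards nor return to a from
  -- above, and leaving and returning downwards would give a two lower neighbours.
  no-cycle : ∀ a rest → Unique (a ∷ rest) → 2 ≤ length rest → ¬ Linked R ((a ∷ rest) ∷ʳ a)
  no-cycle a (c ∷ [])    _ (s≤s ())
  no-cycle a (c ∷ w ∷ t) u@(a∉ ∷ c∉ ∷ _) _ l@(Rac ∷ _) = impossible
    where
    d : A
    d = last w t

    Rda : R d a
    Rda = subst₂ R (penultimate-∷ʳ a c (w ∷ t) a) (last-∷ʳ c (w ∷ t) a) (last-step a c (w ∷ t ∷ʳ a) l)

    c≢d : c ≢ d
    c≢d c≡d = All.lookup c∉ (last-∈ w t) c≡d

    nb : NonBacktracking (a ∷ c ∷ (w ∷ t ∷ʳ a))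
    nb = nonBacktracking-∷ʳ a c (w ∷ t) a (unique⇒nonBacktracking _ u)
           (λ e → All.lookup a∉ (penultimate-∈ a c w t) (sym e))

    impossible : ⊥
    impossible with <-or-> Rac | <-or-> Rda
    ... | inj₁ a<c | _ =
      <-irrefl refl (subst (λ z → rank a < rank z) (last-∷ʳ c (w ∷ t) a) (rises-to-last a c (w ∷ t ∷ʳ a) l nb a<c))
    ... | inj₂ c<a | inj₁ d<a = c≢d (lower-unique Rac (R-sym Rda) c<a d<a)
    ... | inj₂ _   | inj₂ a<d =
      <-irrefl refl (subst (λ z → rank z < rank a) (last-∷ʳ c (w ∷ t) a)
        (falls-from-first a c (w ∷ t ∷ʳ a) l nb
          (subst₂ (λ p q → rank p < rank q) (sym (last-∷ʳ c (w ∷ t) a)) (sym (penultimate-∷ʳ a c (w ∷ t) a)) a<d)))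

least-witness : (P : ℕ → Set) → Decidable P → ∀ m → P m → Σ ℕ λ k → P k × (∀ j → j < k → ¬ P j)
least-witness P P? m Pm with search (suc m)
  where
  search : ∀ m → (∀ j → j < m → ¬ P j) ⊎ Σ ℕ λ k → P k × (∀ j → j < k → ¬ P j)
  search zero = inj₁ λ _ ()
  search (suc m) with search m
  ... | inj₂ found = inj₂ found
  ... | inj₁ none-below with P? m
  ... | yes Pm  = inj₂ (m , Pm , none-below)
  ... | no ¬Pm = inj₁ λ j j<1+m → [ none-below j , (λ { refl → ¬Pm }) ]′ (m≤n⇒m<n∨m≡n (≤-pred j<1+m))
... | inj₁ none-below = ⊥-elim (none-below m ≤-refl Pm)
... | inj₂ found      = found

∅ᴱ : ∀ {n} → ERel n
∅ᴱ _ _ = false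

module _ {n : ℕ} where

  open Counting
  open Reachability

  ∅ᴱ-acyclic : Acyclic (∅ᴱ {n})
  ∅ᴱ-acyclic a (r ∷ rs) _ _ (() ∷ _)

  deg-∅ᴱ : ∀ v → deg (∅ᴱ {n}) v ≡ 0
  deg-∅ᴱ v = trans (deg≡count ∅ᴱ v) (count-none n (λ _ → refl))

  reach-∅ᴱ : ∀ {u v : Fin n} → Reach ∅ᴱ u v → u ≡ v
  reach-∅ᴱ = reach-from-isolated (λ _ → refl)

module CubicWithPerfectMatching {n : ℕ} (G M : ERel n) (G-sym : SymmetricE G) (G-irrefl : IrreflexiveE G)
  (cubic : ∀ v → deg G v ≡ 3) (perfect : IsPerfectMatching G M) where

  open Counting

  H : ERel n
  H = G ∖ᴱ M

  M-sym : SymmetricE M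
  M-sym = proj₁ perfect

  M⊆G : M ⊆ᴱ G
  M⊆G = proj₁ (proj₂ perfect)

  H-sym : SymmetricE H
  H-sym u v rewrite G-sym u v | M-sym u v = refl

  H-irrefl : IrreflexiveE H
  H-irrefl v rewrite G-irrefl v = refl

  M-irrefl : IrreflexiveE M
  M-irrefl v with M v v in Mvv
  ... | false = refl
  ... | true with trans (sym (M⊆G v v Mvv)) (G-irrefl v)
  ... | ()

  H⇒G : ∀ {u v} → H u v ≡ true → G u v ≡ true
  H⇒G {u} {v} Huv with G u v
  H⇒G () | false
  ... | true = refl

  H⇒¬M : ∀ {u v} → H u v ≡ true → M u v ≡ false
  H⇒¬M {u} {v} Huv with G u v | M u v
  H⇒¬M () | false | _
  H⇒¬M () | true  | true
  ... | true | false = refl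

  M⇒¬H : ∀ {u v} → M u v ≡ true → H u v ≡ false
  M⇒¬H {u} {v} Muv rewrite Muv = ∧-zeroʳ (G u v)

  G⇒H⊎M : ∀ {u v} → G u v ≡ true → H u v ≡ true ⊎ M u v ≡ true
  G⇒H⊎M {u} {v} Guv with M u v
  ... | true  = inj₂ refl
  ... | false rewrite Guv = inj₁ refl

  H≢M : ∀ {v p q} → H v p ≡ true → M v q ≡ true → p ≢ q
  H≢M Hvp Mvq refl with trans (sym (M⇒¬H Mvq)) Hvp
  ... | ()

  H-2-regular : ∀ v → count n (H v) ≡ 2
  H-2-regular v = +-cancelʳ-≡ 1 (count n (H v)) 2 (begin
    count n (H v) + 1            ≡⟨ cong (count n (H v) +_) (sym (trans (sym (deg≡count M v)) (proj₂ (proj₂ perfect) v))) ⟩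
    count n (H v) + count n (M v) ≡⟨ count-+ n (H v) (M v) (G v) split ⟩
    count n (G v)                ≡⟨ trans (sym (deg≡count G v)) (cubic v) ⟩
    3                            ∎)
    where
    open ≡-Reasoning
    split : ∀ i → b2n (H v i) + b2n (M v i) ≡ b2n (G v i)
    split i with G v i in Gvi | M v i in Mvi
    ... | true  | true  = refl
    ... | true  | false = refl
    ... | false | false = refl
    ... | false | true with trans (sym (M⊆G v i Mvi)) Gvi
    ... | ()

  opaque
    H-neighbours : ∀ v → Σ (Fin n) λ p → Σ (Fin n) λ q → p ≢ q × H v p ≡ true × H v q ≡ true ×
                   (∀ i → H v i ≡ true → i ≡ p ⊎ i ≡ q)
    H-neighbours v = count≡2⇒pair n (H-2-regular v)

  private
    mate-spec : ∀ v → Σ (Fin n) λ p → M v p ≡ true × (∀ i → M v i ≡ true → i ≡ p)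
    mate-spec v = count≡1⇒unique n (trans (sym (deg≡count M v)) (proj₂ (proj₂ perfect) v))

  mate : Fin n → Fin n
  mate v = proj₁ (mate-spec v)

  M-mate : ∀ v → M v (mate v) ≡ true
  M-mate v = proj₁ (proj₂ (mate-spec v))

  M⇒mate : ∀ {v i} → M v i ≡ true → i ≡ mate v
  M⇒mate {v} {i} = proj₂ (proj₂ (mate-spec v)) i

  mate-involutive : ∀ v → mate (mate v) ≡ v
  mate-involutive v = sym (M⇒mate (trans (M-sym (mate v) v) (M-mate v)))

  mate-≢ : ∀ v → v ≢ mate v
  mate-≢ v v≡mate with trans (sym (M-irrefl v)) (subst (λ z → M v z ≡ true) (sym v≡mate) (M-mate v))
  ... | ()

  module Component (c : Fin n) (S : VSet n) (component : IsComponentOf H c S) where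

    open Reachability

    S⇒reach : ∀ {v} → S v ≡ true → Reach H c v
    S⇒reach {v} = Equivalence.to (component v)

    S-closed : ∀ {u v} → S u ≡ true → H u v ≡ true → S v ≡ true
    S-closed Su Huv = Equivalence.from (component _) (reach-snoc (S⇒reach Su) Huv)

    S-connected : ∀ {u v} → S u ≡ true → S v ≡ true → Reach H u v
    S-connected Su Sv = reach-trans (reach-sym H-sym (S⇒reach Su)) (S⇒reach Sv)

    GS : ERel n
    GS = Induced G S

    GS-S₁ : ∀ {u v} → GS u v ≡ true → S u ≡ true
    GS-S₁ {u} e with S u
    GS-S₁ () | false
    ... | true = refl

    GS-S₂ : ∀ {u v} → GS u v ≡ true → S v ≡ true
    GS-S₂ {u} {v} e with S u | S v
    GS-S₂ () | false | _
    GS-S₂ () | true  | false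
    ... | true | true = refl

    GS-G : ∀ {u v} → GS u v ≡ true → G u v ≡ true
    GS-G {u} {v} e with S u | S v
    GS-G () | false | _
    GS-G () | true  | false
    ... | true | true = e

    GS-intro : ∀ {u v} → S u ≡ true → S v ≡ true → G u v ≡ true → GS u v ≡ true
    GS-intro Su Sv Guv rewrite Su | Sv = Guv

    GS-sym : SymmetricE GS
    GS-sym u v rewrite G-sym u v with S u | S v
    ... | true  | true  = refl
    ... | true  | false = refl
    ... | false | true  = refl
    ... | false | false = refl

    H⇒GS : ∀ {u v} → S u ≡ true → H u v ≡ true → GS u v ≡ true
    H⇒GS Su Huv = GS-intro Su (S-closed Su Huv) (H⇒G Huv)

    GS⇒H⊎mate : ∀ {v i} → GS v i ≡ true → H v i ≡ true ⊎ i ≡ mate v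
    GS⇒H⊎mate e with G⇒H⊎M (GS-G e)
    ... | inj₁ Hvi = inj₁ Hvi
    ... | inj₂ Mvi = inj₂ (M⇒mate Mvi)

    GS-outside : ∀ {v} → S v ≡ false → ∀ t → GS v t ≡ false
    GS-outside Sv t rewrite Sv = refl

    GS-¬IsPathEnd : ∀ v → ¬ IsPathEnd GS v
    GS-¬IsPathEnd v with S v in Sv
    ... | false = PathEnds.isolated⇒¬IsPathEnd GS (GS-outside Sv)
    ... | true with H-neighbours v
    ... | p , q , p≢q , Hvp , Hvq , _ = PathEnds.two-neighbours⇒¬IsPathEnd GS p≢q (H⇒GS Sv Hvp) (H⇒GS Sv Hvq)

    boundary⇒mate-outside : ∀ {v} → Boundary G S v → S (mate v) ≡ false
    boundary⇒mate-outside {v} (Sv , deg≡2) with S (mate v) in Smate | H-neighbours v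
    ... | false | _ = refl
    ... | true  | p , q , p≢q , Hvp , Hvq , _ = ⊥-elim (<-irrefl refl (≤-trans
      (3≤count n p q (mate v) p≢q (H≢M Hvp (M-mate v)) (H≢M Hvq (M-mate v))
         (H⇒GS Sv Hvp) (H⇒GS Sv Hvq) (GS-intro Sv Smate (M⊆G v (mate v) (M-mate v))))
      (≤-reflexive (trans (sym (deg≡count GS v)) deg≡2))))

    mate-outside⇒boundary : ∀ {v} → S v ≡ true → S (mate v) ≡ false → Boundary G S v
    mate-outside⇒boundary {v} Sv Smate with H-neighbours v
    ... | p , q , p≢q , Hvp , Hvq , only-pq =
      Sv , trans (deg≡count GS v) (≤-antisym (count≤2 n p q only-H) (2≤count n p q p≢q (H⇒GS Sv Hvp) (H⇒GS Sv Hvq)))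
      where
      only-H : ∀ i → GS v i ≡ true → i ≡ p ⊎ i ≡ q
      only-H i e with GS⇒H⊎mate e
      ... | inj₁ Hvi = only-pq i Hvi
      ... | inj₂ refl with trans (sym Smate) (GS-S₂ e)
      ... | ()

module CycleWalk {n : ℕ} (G M : ERel n) (G-sym : SymmetricE G) (G-irrefl : IrreflexiveE G)
  (cubic : ∀ v → deg G v ≡ 3) (perfect : IsPerfectMatching G M)
  (c : Fin n) (S : VSet n) (component : IsComponentOf (G ∖ᴱ M) c S) (x : Fin n) (Sx : S x ≡ true) where

  open CubicWithPerfectMatching G M G-sym G-irrefl cubic perfect
  open Component c S component

  other-neighbour : Fin n → Fin n → Fin n
  other-neighbour v u with H-neighbours v
  ... | p , q , _ with u ≟ p
  ... | yes _ = q
  ... | no _  = p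

  other-neighbour-spec : ∀ v u → H v u ≡ true →
    H v (other-neighbour v u) ≡ true × other-neighbour v u ≢ u ×
    (∀ t → H v t ≡ true → t ≡ u ⊎ t ≡ other-neighbour v u)
  other-neighbour-spec v u Hvu with H-neighbours v
  ... | p , q , p≢q , Hvp , Hvq , only-pq with u ≟ p
  ... | yes refl = Hvq , (p≢q ∘′ sym) , only-pq
  ... | no u≢p with only-pq u Hvu
  ... | inj₁ u≡p = ⊥-elim (u≢p u≡p)
  ... | inj₂ refl = Hvp , p≢q , λ t Hvt → swap (only-pq t Hvt)

  private
    walk-pair : ℕ → Fin n × Fin n
    walk-pair zero    = x , proj₁ (H-neighbours x)
    walk-pair (suc i) = proj₂ (walk-pair i) , other-neighbour (proj₂ (walk-pair i)) (proj₁ (walk-pair i))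

  walk : ℕ → Fin n
  walk i = proj₁ (walk-pair i)

  walk-H : ∀ i → H (walk i) (walk (suc i)) ≡ true
  walk-H zero    = proj₁ (proj₂ (proj₂ (proj₂ (H-neighbours x))))
  walk-H (suc i) = proj₁ (other-neighbour-spec (walk (suc i)) (walk i) (trans (H-sym _ _) (walk-H i)))

  walk-H⁻ : ∀ i → H (walk (suc i)) (walk i) ≡ true
  walk-H⁻ i = trans (H-sym _ _) (walk-H i)

  walk-no-backtrack : ∀ i → walk (suc (suc i)) ≢ walk i
  walk-no-backtrack i = proj₁ (proj₂ (other-neighbour-spec (walk (suc i)) (walk i) (walk-H⁻ i)))

  walk-neighbours : ∀ i t → H (walk (suc i)) t ≡ true → t ≡ walk i ⊎ t ≡ walk (suc (suc i))
  walk-neighbours i = proj₂ (proj₂ (other-neighbour-spec (walk (suc i)) (walk i) (walk-H⁻ i)))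

  walk-no-loop : ∀ i → walk (suc i) ≢ walk i
  walk-no-loop i e with trans (sym (H-irrefl (walk i))) (subst (λ z → H (walk i) z ≡ true) e (walk-H i))
  ... | ()

  walk-S : ∀ i → S (walk i) ≡ true
  walk-S zero    = Sx
  walk-S (suc i) = S-closed (walk-S i) (walk-H i)

  Revisits : ℕ → Set
  Revisits j = Σ ℕ λ i → i < j × walk i ≡ walk j

  private
    revisits? : Decidable Revisits
    revisits? j with Fin.any? {n = j} (λ f → walk (toℕ f) ≟ walk j)
    ... | yes (f , e) = yes (toℕ f , Fin.toℕ<n f , e)
    ... | no none     = no λ (i , i<j , e) →
      none (fromℕ< i<j , subst (λ z → walk z ≡ walk j) (sym (Fin.toℕ-fromℕ< i<j)) e)

    eventually-revisits : Σ ℕ Revisits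
    eventually-revisits with Fin.pigeonhole (n<1+n n) (λ (j : Fin (suc n)) → walk (toℕ j))
    ... | i , j , i<j , e = toℕ j , toℕ i , i<j , e

  opaque
    first-revisit : Σ ℕ λ k → Revisits k × (∀ j → j < k → ¬ Revisits j)
    first-revisit = least-witness Revisits revisits? (proj₁ eventually-revisits) (proj₂ eventually-revisits)

  k : ℕ
  k = proj₁ first-revisit

  k-minimal : ∀ j → j < k → ¬ Revisits j
  k-minimal = proj₂ (proj₂ first-revisit)

  -- A first revisit w_{1+j} = w_{1+i} with i < j would make w_j a neighbour of w_{1+i}, i.e. w_i
  -- or w_{2+i}, giving an earlier revisit or a backtrack; so the first revisit returns to w₀ = x.
  walk-k≡x : walk k ≡ x
  walk-k≡x with k | proj₁ (proj₂ first-revisit) | k-minimal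
  ... | zero   | _ , () , _ | _
  ... | suc j  | zero , _ , e | _ = sym e
  ... | suc j  | suc i , 1+i<1+j , e | minimal with walk-neighbours i (walk j) (subst (λ z → H z (walk j) ≡ true) (sym e) (walk-H⁻ j))
  ... | inj₁ e′ = ⊥-elim (minimal j ≤-refl (i , ≤-pred 1+i<1+j , sym e′))
  ... | inj₂ e′ with <-cmp (suc (suc i)) j
  ... | tri< lt _ _ = ⊥-elim (minimal j ≤-refl (suc (suc i) , lt , sym e′))
  ... | tri≈ _ refl _ = ⊥-elim (walk-no-backtrack (suc i) (sym e))
  ... | tri> _ _ gt rewrite ≤-antisym (≤-pred gt) (≤-pred 1+i<1+j) = ⊥-elim (walk-no-loop (suc i) (sym e))

  0<k : 0 < k
  0<k with proj₁ (proj₂ first-revisit)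
  ... | (i , i<k , _) = ≤-<-trans z≤n i<k

  3≤k : 3 ≤ k
  3≤k = closes-late k walk-k≡x 0<k
    where
    closes-late : ∀ m → walk m ≡ x → 0 < m → 3 ≤ m
    closes-late (suc zero)          e _ = ⊥-elim (walk-no-loop 0 e)
    closes-late (suc (suc zero))    e _ = ⊥-elim (walk-no-backtrack 0 e)
    closes-late (suc (suc (suc m))) e _ = s≤s (s≤s (s≤s z≤n))

  walk-injective : ∀ {i j} → i < k → j < k → walk i ≡ walk j → i ≡ j
  walk-injective {i} {j} i<k j<k e with <-cmp i j
  ... | tri< lt _ _ = ⊥-elim (k-minimal j j<k (i , lt , e))
  ... | tri≈ _ eq _ = eq
  ... | tri> _ _ gt = ⊥-elim (k-minimal i i<k (j , gt , sym e))

  k-1 : ℕ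
  k-1 = k ∸ 1

  1+[k-1]≡k : suc k-1 ≡ k
  1+[k-1]≡k = m+[n∸m]≡n {1} {k} (≤-trans (s≤s z≤n) 3≤k)

  k-1<k : k-1 < k
  k-1<k = ≤-reflexive 1+[k-1]≡k

  H-walk[k-1]-x : H (walk k-1) x ≡ true
  H-walk[k-1]-x = subst (λ z → H (walk k-1) z ≡ true) (trans (cong walk 1+[k-1]≡k) walk-k≡x) (walk-H k-1)

  x-neighbours : ∀ t → H x t ≡ true → t ≡ walk 1 ⊎ t ≡ walk k-1
  x-neighbours t Hxt with only t Hxt | only (walk k-1) (trans (H-sym _ _) H-walk[k-1]-x)
    where
    only : ∀ t → H x t ≡ true → t ≡ walk 1 ⊎ t ≡ proj₁ (proj₂ (H-neighbours x))
    only = proj₂ (proj₂ (proj₂ (proj₂ (proj₂ (H-neighbours x)))))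
  ... | inj₁ t≡p | _       = inj₁ t≡p
  ... | inj₂ t≡q | inj₂ e = inj₂ (trans t≡q (sym e))
  ... | inj₂ _   | inj₁ e = ⊥-elim (<-irrefl (sym (walk-injective k-1<k (≤-trans (s≤s (s≤s z≤n)) 3≤k) e)) k-1>1)
    where
    k-1>1 : 1 < k-1
    k-1>1 = ≤-pred (subst (2 <_) (sym 1+[k-1]≡k) 3≤k)

  data Adjacent : ℕ → ℕ → Set where
    forward       : ∀ {p} → Adjacent p (suc p)
    backward      : ∀ {p} → Adjacent (suc p) p
    wrap-forward  : Adjacent k-1 0
    wrap-backward : Adjacent 0 k-1

  Adjacent⇒H : ∀ {p q} → Adjacent p q → H (walk p) (walk q) ≡ true
  Adjacent⇒H {p} forward       = walk-H p
  Adjacent⇒H {q = q} backward  = walk-H⁻ q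
  Adjacent⇒H wrap-forward      = H-walk[k-1]-x
  Adjacent⇒H wrap-backward     = trans (H-sym _ _) H-walk[k-1]-x

  H⇒Adjacent : ∀ p t → p < k → H (walk p) t ≡ true → Σ ℕ λ q → q < k × t ≡ walk q × Adjacent p q
  H⇒Adjacent zero t _ Hxt with x-neighbours t Hxt
  ... | inj₁ e = 1 , ≤-trans (s≤s (s≤s z≤n)) 3≤k , e , forward
  ... | inj₂ e = k-1 , k-1<k , e , wrap-backward
  H⇒Adjacent (suc p) t 1+p<k H[1+p]t with walk-neighbours p t H[1+p]t
  ... | inj₁ e = p , <-trans (n<1+n p) 1+p<k , e , backward
  ... | inj₂ e with m≤n⇒m<n∨m≡n 1+p<k
  ... | inj₁ 2+p<k = suc (suc p) , 2+p<k , e , forward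
  ... | inj₂ 2+p≡k =
    0 , 0<k , trans e (trans (cong walk 2+p≡k) walk-k≡x) ,
    subst (λ z → Adjacent z 0) (suc-injective (trans 1+[k-1]≡k (sym 2+p≡k))) wrap-forward

  OnCycle : Fin n → Set
  OnCycle v = Σ ℕ λ p → p < k × walk p ≡ v

  private
    on-cycle-closed : ∀ {u t} → OnCycle u → H u t ≡ true → OnCycle t
    on-cycle-closed (p , p<k , refl) Hut with H⇒Adjacent p _ p<k Hut
    ... | q , q<k , e , _ = q , q<k , sym e

    reach-on-cycle : ∀ {u v} → OnCycle u → Reach H u v → OnCycle v
    reach-on-cycle on here       = on
    reach-on-cycle on (step e r) = reach-on-cycle (on-cycle-closed on e) r

  S⇒OnCycle : ∀ {v} → S v ≡ true → OnCycle v
  S⇒OnCycle Sv = reach-on-cycle (0 , 0<k , refl) (S-connected Sx Sv)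

  opaque
    pos : Fin n → ℕ
    pos v with Fin.any? {n = k} (λ f → walk (toℕ f) ≟ v)
    ... | yes (f , _) = toℕ f
    ... | no _        = 0

    pos-spec : ∀ {v} → S v ≡ true → pos v < k × walk (pos v) ≡ v
    pos-spec {v} Sv with Fin.any? {n = k} (λ f → walk (toℕ f) ≟ v)
    ... | yes (f , e) = Fin.toℕ<n f , e
    ... | no none with S⇒OnCycle Sv
    ... | p , p<k , e = ⊥-elim (none (fromℕ< p<k , subst (λ z → walk z ≡ v) (sym (Fin.toℕ-fromℕ< p<k)) e))

  pos-walk : ∀ {p} → p < k → pos (walk p) ≡ p
  pos-walk {p} p<k = walk-injective (proj₁ (pos-spec (walk-S p))) p<k (proj₂ (pos-spec (walk-S p)))

  S⇒walk : ∀ {v} → S v ≡ true → Σ ℕ λ p → p < k × v ≡ walk p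
  S⇒walk Sv = pos _ , proj₁ (pos-spec Sv) , sym (proj₂ (pos-spec Sv))

  GS-walk-neighbour : ∀ {p v} → p < k → GS (walk p) v ≡ true →
                      (Σ ℕ λ q → q < k × v ≡ walk q × Adjacent p q) ⊎ M (walk p) v ≡ true
  GS-walk-neighbour {p} {v} p<k e with GS⇒H⊎mate e
  ... | inj₁ H[p]v = inj₁ (H⇒Adjacent p v p<k H[p]v)
  ... | inj₂ refl  = inj₂ (M-mate (walk p))

module ChordlessCycle {n : ℕ} (G M : ERel n) (G-sym : SymmetricE G) (G-irrefl : IrreflexiveE G)
  (cubic : ∀ v → deg G v ≡ 3) (perfect : IsPerfectMatching G M)
  (c : Fin n) (S : VSet n) (component : IsComponentOf (G ∖ᴱ M) c S) (x : Fin n)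
  (chordless : ∀ v → S v ≡ true → S (CubicWithPerfectMatching.mate G M G-sym G-irrefl cubic perfect v) ≡ false) where

  open Counting
  open CubicWithPerfectMatching G M G-sym G-irrefl cubic perfect
  open Component c S component

  decomposition : Decomposition G S (λ _ → ⊥) (λ _ → ⊥) (_≡ x) (λ w → Boundary G S w × w ≢ x)
  decomposition = record
    { F                = ∅ᴱ
    ; 𝒞                = GS
    ; Mi               = ∅ᴱ
    ; F-sym            = λ _ _ → refl
    ; 𝒞-sym            = GS-sym
    ; Mi-sym           = λ _ _ → refl
    ; F-sub            = λ _ _ ()
    ; 𝒞-sub            = λ _ _ e → e
    ; Mi-sub           = λ _ _ ()
    ; cover            = λ u v e → cong (λ z → b2n z + 0) e
    ; forest           = ∅ᴱ-acyclic
    ; maxdeg2          = GS-deg≤2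
    ; matching         = λ v → subst (_≤ 1) (sym (deg-∅ᴱ v)) z≤n
    ; cond-i-nonempty  = λ v Sv → v , here , marked v Sv
    ; cond-i-atmostone = λ v _ w₁ w₂ r₁ r₂ _ _ _ _ → trans (sym (reach-∅ᴱ r₁)) (reach-∅ᴱ r₂)
    ; cond-ii          = λ w → mk⇔ (GS-¬IsPathEnd w) ⊥-elim
    }
    where
    GS-deg≤2 : ∀ v → deg GS v ≤ 2
    GS-deg≤2 v with S v ≟ᵇ true
    ... | yes Sv  = ≤-reflexive (proj₂ (mate-outside⇒boundary Sv (chordless v Sv)))
    ... | no ¬Sv = subst (_≤ 2) (sym (trans (deg≡count GS v) (count-none n (GS-outside (¬-not ¬Sv))))) z≤n
    marked : ∀ v → S v ≡ true → (Boundary G S v × v ≢ x) ⊎ v ≡ x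
    marked v Sv with v ≟ x
    ... | yes v≡x = inj₂ v≡x
    ... | no v≢x  = inj₁ (mate-outside⇒boundary Sv (chordless v Sv) , v≢x)

module ChordedCycle {n : ℕ} (G M : ERel n) (G-sym : SymmetricE G) (G-irrefl : IrreflexiveE G)
  (cubic : ∀ v → deg G v ≡ 3) (perfect : IsPerfectMatching G M)
  (c : Fin n) (S : VSet n) (component : IsComponentOf (G ∖ᴱ M) c S) (x : Fin n) (∂x : Boundary G S x) where

  open Counting
  open CubicWithPerfectMatching G M G-sym G-irrefl cubic perfect
  open Component c S component
  open CycleWalk G M G-sym G-irrefl cubic perfect c S component x (proj₁ ∂x)

  -- 1 ≤ a excludes x = walk 0, whose partner is off the cycle.
  ChordOfSpan : ℕ → Set
  ChordOfSpan d = Σ ℕ λ a → 1 ≤ a × a + d < k × M (walk a) (walk (a + d)) ≡ true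

  chordOfSpan? : Decidable ChordOfSpan
  chordOfSpan? d with Fin.any? {n = k} (λ f → (1 ≤? toℕ f) ×-dec ((toℕ f + d <? k) ×-dec (M (walk (toℕ f)) (walk (toℕ f + d)) ≟ᵇ true)))
  ... | yes (f , chord) = yes (toℕ f , chord)
  ... | no none = no λ (a , chord@(_ , a+d<k , _)) →
    none (fromℕ< (≤-<-trans (m≤m+n a d) a+d<k) ,
          subst (λ z → 1 ≤ z × z + d < k × M (walk z) (walk (z + d)) ≡ true)
                (sym (Fin.toℕ-fromℕ< (≤-<-trans (m≤m+n a d) a+d<k))) chord)

  private
    pos≢0 : ∀ {v} → S v ≡ true → v ≢ x → pos v ≢ 0
    pos≢0 Sv v≢x pos≡0 = v≢x (trans (sym (proj₂ (pos-spec Sv))) (cong walk pos≡0))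

    chord-between : ∀ {u v} → S u ≡ true → S v ≡ true → u ≢ x → pos u < pos v → M u v ≡ true → Σ ℕ ChordOfSpan
    chord-between {u} {v} Su Sv u≢x lt Muv =
      pos v ∸ pos u , pos u , n≢0⇒n>0 (pos≢0 Su u≢x) ,
      subst (_< k) (sym pu+d≡pv) (proj₁ (pos-spec Sv)) ,
      subst₂ (λ p q → M p q ≡ true) (sym (proj₂ (pos-spec Su))) (trans (sym (proj₂ (pos-spec Sv))) (cong walk (sym pu+d≡pv))) Muv
      where
      pu+d≡pv : pos u + (pos v ∸ pos u) ≡ pos v
      pu+d≡pv = m+[n∸m]≡n (<⇒≤ lt)

    mate-inside⇒≢x : ∀ {v} → S (mate v) ≡ true → v ≢ x
    mate-inside⇒≢x Smv refl with trans (sym Smv) (boundary⇒mate-outside ∂x)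
    ... | ()

  chord⇒ChordOfSpan : ∀ v → S v ≡ true → S (mate v) ≡ true → Σ ℕ ChordOfSpan
  chord⇒ChordOfSpan v Sv Smv with <-cmp (pos v) (pos (mate v))
  ... | tri< lt _ _ = chord-between Sv Smv (mate-inside⇒≢x Smv) lt (M-mate v)
  ... | tri≈ _ eq _ = ⊥-elim (mate-≢ v (trans (sym (proj₂ (pos-spec Sv))) (trans (cong walk eq) (proj₂ (pos-spec Smv)))))
  ... | tri> _ _ gt = chord-between Smv Sv (mate-inside⇒≢x (subst (λ z → S z ≡ true) (sym (mate-involutive v)) Sv)) gt
                        (trans (M-sym _ _) (M-mate v))

  span≥2 : ∀ a d → M (walk a) (walk (a + d)) ≡ true → 2 ≤ d
  span≥2 a zero          Maa rewrite +-identityʳ a with trans (sym (M-irrefl (walk a))) Maa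
  ... | ()
  span≥2 a (suc zero)    Ma[a+1] rewrite +-comm a 1 = ⊥-elim (H≢M (walk-H a) Ma[a+1] refl)
  span≥2 a (suc (suc d)) _ = s≤s (s≤s z≤n)

  module ShortestChord (a d : ℕ) (1≤a : 1 ≤ a) (a+d<k : a + d < k) (Mab : M (walk a) (walk (a + d)) ≡ true)
    (shortest : ∀ d′ → d′ < d → ¬ ChordOfSpan d′) where

    b : ℕ
    b = a + d

    a<k : a < k
    a<k = ≤-<-trans (m≤m+n a d) a+d<k

    b<k : b < k
    b<k = a+d<k

    1+a<b : suc a < b
    1+a<b = subst (_≤ a + d) (+-comm a 2) (+-monoʳ-≤ a (span≥2 a d Mab))

    a<b : a < b
    a<b = <-trans (n<1+n a) 1+a<b

    b≤k-1 : b ≤ k-1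
    b≤k-1 = ≤-pred (subst (b <_) (sym 1+[k-1]≡k) b<k)

    mate-a : mate (walk a) ≡ walk b
    mate-a = sym (M⇒mate Mab)

    mate-b : mate (walk b) ≡ walk a
    mate-b = sym (M⇒mate (trans (M-sym _ _) Mab))

    InArc Interior : ℕ → Set
    InArc p    = a ≤ p × p ≤ b
    Interior p = a < p × p < b

    Interior⇒InArc : ∀ {p} → Interior p → InArc p
    Interior⇒InArc (a<p , p<b) = <⇒≤ a<p , <⇒≤ p<b

    InArc-a : InArc a
    InArc-a = ≤-refl , <⇒≤ a<b

    InArc-b : InArc b
    InArc-b = <⇒≤ a<b , ≤-refl

    arc-cases : ∀ {p} → InArc p → p ≡ a ⊎ p ≡ b ⊎ Interior p
    arc-cases (a≤p , p≤b) with m≤n⇒m<n∨m≡n a≤p | m≤n⇒m<n∨m≡n p≤b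
    ... | inj₂ a≡p | _        = inj₁ (sym a≡p)
    ... | inj₁ _   | inj₂ p≡b = inj₂ (inj₁ p≡b)
    ... | inj₁ a<p | inj₁ p<b = inj₂ (inj₂ (a<p , p<b))

    private
      no-shorter-chord : ∀ {p q} → a < p → q < b → p < q → M (walk p) (walk q) ≡ true → ⊥
      no-shorter-chord {p} {q} a<p q<b p<q Mpq =
        shortest (q ∸ p) span<d (p , ≤-trans 1≤a (<⇒≤ a<p) , subst (_< k) (sym p+[q∸p]≡q) (<-trans q<b b<k) ,
                                 subst (λ z → M (walk p) (walk z) ≡ true) (sym p+[q∸p]≡q) Mpq)
        where
        p+[q∸p]≡q : p + (q ∸ p) ≡ q
        p+[q∸p]≡q = m+[n∸m]≡n (<⇒≤ p<q)
        span<d : q ∸ p < d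
        span<d = +-cancelˡ-< a (q ∸ p) d (<-trans (+-monoˡ-< (q ∸ p) a<p) (subst (_< a + d) (sym p+[q∸p]≡q) q<b))

    interior-mate-outside : ∀ {p q} → Interior p → q < k → M (walk p) (walk q) ≡ true → ¬ InArc q
    interior-mate-outside {p} {q} (a<p , p<b) q<k Mpq (a≤q , q≤b) with <-cmp q p
    ... | tri≈ _ refl _ with trans (sym (M-irrefl (walk p))) Mpq
    ... | ()
    interior-mate-outside {p} {q} (a<p , p<b) q<k Mpq (a≤q , q≤b) | tri< q<p _ _ with m≤n⇒m<n∨m≡n a≤q
    ... | inj₁ a<q  = no-shorter-chord a<q p<b q<p (trans (M-sym _ _) Mpq)
    ... | inj₂ refl = <-irrefl (walk-injective (<-trans p<b b<k) b<k (trans (M⇒mate (trans (M-sym _ _) Mpq)) mate-a)) p<b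
    interior-mate-outside {p} {q} (a<p , p<b) q<k Mpq (a≤q , q≤b) | tri> _ _ p<q with m≤n⇒m<n∨m≡n q≤b
    ... | inj₁ q<b  = no-shorter-chord a<p q<b p<q Mpq
    ... | inj₂ refl = <-irrefl (walk-injective a<k (<-trans p<b b<k) (trans (sym mate-b) (sym (M⇒mate (trans (M-sym _ _) Mpq))))) a<p

    chord-from-arc-is-interior : ∀ {p q} → q < k → M (walk p) (walk q) ≡ true → InArc p → ¬ InArc q → Interior p
    chord-from-arc-is-interior {p} {q} q<k Mpq p∈ q∉ with arc-cases p∈
    ... | inj₁ refl = ⊥-elim (q∉ (subst InArc (walk-injective b<k q<k (trans (sym mate-a) (sym (M⇒mate Mpq)))) InArc-b))
    ... | inj₂ (inj₁ refl) = ⊥-elim (q∉ (subst InArc (walk-injective a<k q<k (trans (sym mate-b) (sym (M⇒mate Mpq)))) InArc-a))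
    ... | inj₂ (inj₂ p∘) = p∘

    inArc? : ∀ p → Dec (InArc p)
    inArc? p = (a ≤? p) ×-dec (p ≤? b)

    inArc : Fin n → Bool
    inArc v = S v ∧ does (inArc? (pos v))

    private
      does-true : ∀ {P : Set} (P? : Dec P) → does P? ≡ true → P
      does-true (yes p) _ = p

      ∧-true : ∀ {x y} → x ∧ y ≡ true → x ≡ true × y ≡ true
      ∧-true {true} {true} _ = refl , refl

      not-true : ∀ {x} → not x ≡ true → x ≡ false
      not-true {false} _ = refl

    inArc-walk : ∀ {p} → p < k → inArc (walk p) ≡ does (inArc? p)
    inArc-walk {p} p<k rewrite walk-S p | pos-walk p<k = refl

    inArc⇒S : ∀ {v} → inArc v ≡ true → S v ≡ true
    inArc⇒S e = proj₁ (∧-true e)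

    inArc⇒InArc : ∀ {p} → p < k → inArc (walk p) ≡ true → InArc p
    inArc⇒InArc {p} p<k e = does-true (inArc? p) (trans (sym (inArc-walk p<k)) e)

    InArc⇒inArc : ∀ {p} → p < k → InArc p → inArc (walk p) ≡ true
    InArc⇒inArc {p} p<k p∈ = trans (inArc-walk p<k) (dec-true (inArc? p) p∈)

    ¬InArc⇒inArc : ∀ {p} → p < k → ¬ InArc p → inArc (walk p) ≡ false
    ¬InArc⇒inArc {p} p<k p∉ = trans (inArc-walk p<k) (dec-false (inArc? p) p∉)

    bothInArc outerChord : ERel n
    bothInArc u v  = inArc u ∧ inArc v
    outerChord u v = M u v ∧ (not (inArc u) ∧ not (inArc v))

    F 𝒞 Mᵢ : ERel n
    𝒞 u v  = GS u v ∧ bothInArc u v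
    Mᵢ u v = GS u v ∧ outerChord u v
    F u v  = GS u v ∧ (not (bothInArc u v) ∧ not (outerChord u v))

    F-sym : SymmetricE F
    F-sym u v rewrite GS-sym u v | M-sym u v | ∧-comm (inArc u) (inArc v) | ∧-comm (not (inArc u)) (not (inArc v)) = refl

    𝒞-sym : SymmetricE 𝒞
    𝒞-sym u v rewrite GS-sym u v | ∧-comm (inArc u) (inArc v) = refl

    Mᵢ-sym : SymmetricE Mᵢ
    Mᵢ-sym u v rewrite GS-sym u v | M-sym u v | ∧-comm (not (inArc u)) (not (inArc v)) = refl

    partition : ∀ u v → GS u v ≡ true → b2n (F u v) + b2n (𝒞 u v) + b2n (Mᵢ u v) ≡ 1
    partition u v GSuv rewrite GSuv with inArc u | inArc v | M u v
    ... | true  | true  | true  = refl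
    ... | true  | true  | false = refl
    ... | true  | false | true  = refl
    ... | true  | false | false = refl
    ... | false | true  | true  = refl
    ... | false | true  | false = refl
    ... | false | false | true  = refl
    ... | false | false | false = refl

    F⊆GS : F ⊆ᴱ GS
    F⊆GS u v = proj₁ ∘ ∧-true {GS u v}

    𝒞⊆GS : 𝒞 ⊆ᴱ GS
    𝒞⊆GS u v = proj₁ ∘ ∧-true {GS u v}

    Mᵢ⊆GS : Mᵢ ⊆ᴱ GS
    Mᵢ⊆GS u v = proj₁ ∘ ∧-true {GS u v}

    Mᵢ-matching : ∀ v → deg Mᵢ v ≤ 1
    Mᵢ-matching v = subst (_≤ 1) (sym (deg≡count Mᵢ v))
      (count≤1 n (mate v) λ t e → M⇒mate (proj₁ (∧-true {M v t} (proj₂ (∧-true {GS v t} e)))))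

    𝒞-intro : ∀ {p q} → p < k → q < k → GS (walk p) (walk q) ≡ true → InArc p → InArc q → 𝒞 (walk p) (walk q) ≡ true
    𝒞-intro p<k q<k GSpq p∈ q∈ rewrite GSpq | InArc⇒inArc p<k p∈ | InArc⇒inArc q<k q∈ = refl

    𝒞-outside : ∀ {v} → inArc v ≡ false → ∀ t → 𝒞 v t ≡ false
    𝒞-outside {v} v∉ t rewrite v∉ = ∧-zeroʳ (GS v t)

    𝒞-neighbour : ∀ {p t} → p < k → 𝒞 (walk p) t ≡ true →
      Σ ℕ λ q → q < k × t ≡ walk q × InArc q × (q ≡ suc p ⊎ suc q ≡ p ⊎ M (walk p) (walk q) ≡ true)
    𝒞-neighbour {p} {t} p<k e with ∧-true {GS (walk p) t} e
    ... | GSpt , both with ∧-true {inArc (walk p)} both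
    ... | p∈ , t∈ with S⇒walk (inArc⇒S {t} t∈)
    ... | q , q<k , refl = q , q<k , refl , q∈ , kind
      where
      q∈ : InArc q
      q∈ = inArc⇒InArc q<k t∈
      kind : q ≡ suc p ⊎ suc q ≡ p ⊎ M (walk p) (walk q) ≡ true
      kind with GS-walk-neighbour p<k GSpt
      ... | inj₂ Mpq = inj₂ (inj₂ Mpq)
      ... | inj₁ (q′ , q′<k , e′ , adj) with walk-injective q′<k q<k (sym e′)
      ... | refl with adj
      ... | forward       = inj₁ refl
      ... | backward      = inj₂ (inj₁ refl)
      ... | wrap-forward  = ⊥-elim (<-irrefl refl (≤-trans 1≤a (proj₁ q∈)))
      ... | wrap-backward = ⊥-elim (<-irrefl refl (≤-trans 1≤a (proj₁ (inArc⇒InArc p<k p∈))))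

    𝒞-count≤2 : ∀ v → count n (𝒞 v) ≤ 2
    𝒞-count≤2 v with inArc v ≟ᵇ true
    ... | no v∉ = subst (_≤ 2) (sym (count-none n (𝒞-outside (¬-not v∉)))) z≤n
    ... | yes v∈ with S⇒walk (inArc⇒S {v} v∈)
    ... | p , p<k , refl with arc-cases (inArc⇒InArc p<k v∈)
    ... | inj₁ refl = count≤2 n (walk (suc a)) (walk b) at-a
      where
      at-a : ∀ t → 𝒞 (walk a) t ≡ true → t ≡ walk (suc a) ⊎ t ≡ walk b
      at-a t e with 𝒞-neighbour p<k e
      ... | q , _ , refl , _  , inj₁ refl         = inj₁ refl
      ... | q , _ , refl , q∈ , inj₂ (inj₁ 1+q≡a) = ⊥-elim (<-irrefl (sym 1+q≡a) (s≤s (proj₁ q∈)))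
      ... | q , _ , refl , _  , inj₂ (inj₂ Maq)   = inj₂ (trans (M⇒mate Maq) mate-a)
    ... | inj₂ (inj₁ refl) = count≤2 n (walk (b ∸ 1)) (walk a) at-b
      where
      at-b : ∀ t → 𝒞 (walk b) t ≡ true → t ≡ walk (b ∸ 1) ⊎ t ≡ walk a
      at-b t e with 𝒞-neighbour p<k e
      ... | q , _ , refl , q∈ , inj₁ refl        = ⊥-elim (<-irrefl refl (proj₂ q∈))
      ... | q , _ , refl , _  , inj₂ (inj₁ 1+q≡b) = inj₁ (cong (λ z → walk (z ∸ 1)) 1+q≡b)
      ... | q , _ , refl , _  , inj₂ (inj₂ Mbq)  = inj₂ (trans (M⇒mate Mbq) mate-b)
    ... | inj₂ (inj₂ p∘) = count≤2 n (walk (suc p)) (walk (p ∸ 1)) inside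
      where
      inside : ∀ t → 𝒞 (walk p) t ≡ true → t ≡ walk (suc p) ⊎ t ≡ walk (p ∸ 1)
      inside t e with 𝒞-neighbour p<k e
      ... | q , _   , refl , _  , inj₁ refl        = inj₁ refl
      ... | q , _   , refl , _  , inj₂ (inj₁ refl) = inj₂ refl
      ... | q , q<k , refl , q∈ , inj₂ (inj₂ Mpq)  = ⊥-elim (interior-mate-outside p∘ q<k Mpq q∈)

    𝒞-maxdeg2 : ∀ v → deg 𝒞 v ≤ 2
    𝒞-maxdeg2 v = subst (_≤ 2) (sym (deg≡count 𝒞 v)) (𝒞-count≤2 v)

    private
      𝒞-step : ∀ {p q} → p < k → q < k → Adjacent p q → InArc p → InArc q → 𝒞 (walk p) (walk q) ≡ true
      𝒞-step {p} p<k q<k adj = 𝒞-intro p<k q<k (H⇒GS (walk-S p) (Adjacent⇒H adj))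

      𝒞-chord : 𝒞 (walk a) (walk b) ≡ true
      𝒞-chord = 𝒞-intro a<k b<k (GS-intro (walk-S a) (walk-S b) (M⊆G _ _ Mab)) InArc-a InArc-b

      two-arc-neighbours : ∀ {p} → p < k → InArc p →
        Σ (Fin n) λ u → Σ (Fin n) λ u′ → u ≢ u′ × 𝒞 (walk p) u ≡ true × 𝒞 (walk p) u′ ≡ true
      two-arc-neighbours p<k p∈ with arc-cases p∈
      ... | inj₁ refl =
        walk (suc a) , walk b , (λ e → <-irrefl (walk-injective 1+a<k b<k e) 1+a<b) ,
        𝒞-step a<k 1+a<k forward InArc-a (n≤1+n a , <⇒≤ 1+a<b) , 𝒞-chord
        where
        1+a<k = <-trans 1+a<b b<k
      ... | inj₂ (inj₁ refl) =
        walk a , walk (b ∸ 1) , (λ e → <-irrefl (walk-injective a<k b-1<k e) a<b-1) ,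
        trans (𝒞-sym _ _) 𝒞-chord ,
        𝒞-step b<k b-1<k (subst (λ z → Adjacent z (b ∸ 1)) 1+[b-1]≡b backward) InArc-b (<⇒≤ a<b-1 , m∸n≤m b 1)
        where
        1+[b-1]≡b : suc (b ∸ 1) ≡ b
        1+[b-1]≡b = m+[n∸m]≡n {1} {b} (≤-trans (s≤s z≤n) a<b)
        a<b-1 : a < b ∸ 1
        a<b-1 = ≤-pred (subst (suc (suc a) ≤_) (sym 1+[b-1]≡b) 1+a<b)
        b-1<k : b ∸ 1 < k
        b-1<k = ≤-<-trans (m∸n≤m b 1) b<k
      ... | inj₂ (inj₂ (a<p , p<b)) with a<p
      ... | s≤s {n = p′} a≤p′ =
        walk (suc (suc p′)) , walk p′ , (λ e → <-irrefl (sym (walk-injective 2+p′<k p′<k e)) (m≤n⇒m≤1+n (n<1+n p′))) ,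
        𝒞-step p<k 2+p′<k forward (<⇒≤ a<p , <⇒≤ p<b) (m≤n⇒m≤1+n (<⇒≤ a<p) , p<b) ,
        𝒞-step p<k p′<k backward (<⇒≤ a<p , <⇒≤ p<b) (a≤p′ , ≤-trans (n≤1+n p′) (<⇒≤ p<b))
        where
        2+p′<k = ≤-<-trans p<b b<k
        p′<k = <-trans (n<1+n p′) p<k

    𝒞-¬IsPathEnd : ∀ v → ¬ IsPathEnd 𝒞 v
    𝒞-¬IsPathEnd v with inArc v ≟ᵇ true
    ... | no v∉ = PathEnds.isolated⇒¬IsPathEnd 𝒞 (𝒞-outside (¬-not v∉))
    ... | yes v∈ with S⇒walk (inArc⇒S {v} v∈)
    ... | p , p<k , refl with two-arc-neighbours p<k (inArc⇒InArc p<k v∈)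
    ... | u , u′ , u≢u′ , 𝒞u , 𝒞u′ = PathEnds.two-neighbours⇒¬IsPathEnd 𝒞 u≢u′ 𝒞u 𝒞u′

    data ForestEdge (p q : ℕ) : Set where
      cycle-edge : Adjacent p q → ¬ (InArc p × InArc q) → ForestEdge p q
      chord-out  : M (walk p) (walk q) ≡ true → Interior p → ¬ InArc q → ForestEdge p q
      chord-in   : M (walk p) (walk q) ≡ true → ¬ InArc p → Interior q → ForestEdge p q

    private
      chord-not-outer : ∀ {u v} → M u v ≡ true → outerChord u v ≡ false → inArc u ≡ true ⊎ inArc v ≡ true
      chord-not-outer {u} {v} Muv ¬outer rewrite Muv with inArc u | inArc v
      ... | true  | _    = inj₁ refl
      ... | false | true = inj₂ refl

    F⇒ForestEdge : ∀ {p v} → p < k → F (walk p) v ≡ true → Σ ℕ λ q → q < k × v ≡ walk q × ForestEdge p q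
    F⇒ForestEdge {p} {v} p<k e with ∧-true {GS (walk p) v} e
    ... | GSpv , rest with ∧-true {not (bothInArc (walk p) v)} rest
    ... | ¬both , ¬outer with S⇒walk (GS-S₂ GSpv)
    ... | q , q<k , refl = q , q<k , refl , classify
      where
      not-both : ¬ (InArc p × InArc q)
      not-both (p∈ , q∈) with trans (sym (not-true ¬both)) (cong₂ _∧_ (InArc⇒inArc p<k p∈) (InArc⇒inArc q<k q∈))
      ... | ()
      classify : ForestEdge p q
      classify with GS-walk-neighbour p<k GSpv
      ... | inj₁ (q′ , q′<k , e′ , adj) = cycle-edge (subst (Adjacent p) (walk-injective q′<k q<k (sym e′)) adj) not-both
      ... | inj₂ Mpq with chord-not-outer Mpq (not-true ¬outer)
      ... | inj₁ p∈ = chord-out Mpq (chord-from-arc-is-interior q<k Mpq (inArc⇒InArc p<k p∈) q∉) q∉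
        where q∉ = λ q∈ → not-both (inArc⇒InArc p<k p∈ , q∈)
      ... | inj₂ q∈ = chord-in Mpq p∉ (chord-from-arc-is-interior p<k (trans (M-sym _ _) Mpq) (inArc⇒InArc q<k q∈) p∉)
        where p∉ = λ p∈ → not-both (p∈ , inArc⇒InArc q<k q∈)

    -- Distance to x along the cycle avoiding the arc; interior arc vertices lie above all of these.
    rank : ℕ → ℕ
    rank q with q ≤? a | b ≤? q
    ... | yes _ | _     = q
    ... | no _  | yes _ = k ∸ q
    ... | no _  | no _  = k

    rank-low : ∀ {q} → q ≤ a → rank q ≡ q
    rank-low {q} q≤a with q ≤? a
    ... | yes _   = refl
    ... | no q≰a = ⊥-elim (q≰a q≤a)

    rank-high : ∀ {q} → b ≤ q → rank q ≡ k ∸ q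
    rank-high {q} b≤q with q ≤? a | b ≤? q
    ... | yes q≤a | _      = ⊥-elim (<-irrefl refl (<-≤-trans a<b (≤-trans b≤q q≤a)))
    ... | no _    | yes _  = refl
    ... | no _    | no b≰q = ⊥-elim (b≰q b≤q)

    rank-interior : ∀ {q} → Interior q → rank q ≡ k
    rank-interior {q} (a<q , q<b) with q ≤? a | b ≤? q
    ... | yes q≤a | _      = ⊥-elim (<-irrefl refl (<-≤-trans a<q q≤a))
    ... | no _    | yes b≤q = ⊥-elim (<-irrefl refl (<-≤-trans q<b b≤q))
    ... | no _    | no _    = refl

    rank<k : ∀ {q} → q < k → ¬ Interior q → rank q < k
    rank<k {q} q<k q∉ with q ≤? a | b ≤? q
    ... | yes _   | _       = q<k
    ... | no _    | yes b≤q = ∸-monoʳ-< (≤-trans (≤-trans 1≤a (<⇒≤ a<b)) b≤q) (<⇒≤ q<k)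
    ... | no q≰a | no b≰q  = ⊥-elim (q∉ (≰⇒> q≰a , ≰⇒> b≰q))

    private
      low-step : ∀ {p} → suc p ≤ a → rank p < rank (suc p)
      low-step {p} 1+p≤a rewrite rank-low (≤-trans (n≤1+n p) 1+p≤a) | rank-low 1+p≤a = n<1+n p

      high-step : ∀ {p} → b ≤ p → suc p < k → rank (suc p) < rank p
      high-step {p} b≤p 1+p<k rewrite rank-high b≤p | rank-high (≤-trans b≤p (n≤1+n p)) =
        ∸-monoʳ-< (n<1+n p) (<⇒≤ 1+p<k)

      step-off-arc : ∀ {p} → ¬ (InArc p × InArc (suc p)) → suc p ≤ a ⊎ b ≤ p
      step-off-arc {p} ¬both with suc p ≤? a | b ≤? p
      ... | yes 1+p≤a | _       = inj₁ 1+p≤a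
      ... | no _      | yes b≤p = inj₂ b≤p
      ... | no 1+p≰a  | no b≰p  = ⊥-elim (¬both ((a≤p , <⇒≤ (≰⇒> b≰p)) , (≤-trans a≤p (n≤1+n p) , ≰⇒> b≰p)))
        where
        a≤p : a ≤ p
        a≤p = ≤-pred (≰⇒> 1+p≰a)

      rank-0 : rank 0 ≡ 0
      rank-0 = rank-low z≤n

      rank-k-1 : rank k-1 ≡ 1
      rank-k-1 = trans (rank-high b≤k-1) (subst (λ z → z ∸ k-1 ≡ 1) 1+[k-1]≡k (m+n∸n≡m 1 k-1))

      swap-¬both : ∀ {p q} → ¬ (InArc p × InArc q) → ¬ (InArc q × InArc p)
      swap-¬both ¬both (q∈ , p∈) = ¬both (p∈ , q∈)

      ¬InArc⇒¬Interior : ∀ {q} → ¬ InArc q → ¬ Interior q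
      ¬InArc⇒¬Interior q∉ q∘ = q∉ (Interior⇒InArc q∘)

    ForestEdge-rank-≢ : ∀ {p q} → p < k → q < k → ForestEdge p q → rank p ≢ rank q
    ForestEdge-rank-≢ {p} _ q<k (cycle-edge forward ¬both) with step-off-arc ¬both
    ... | inj₁ 1+p≤a = <⇒≢ (low-step 1+p≤a)
    ... | inj₂ b≤p   = ≢-sym (<⇒≢ (high-step b≤p q<k))
    ForestEdge-rank-≢ {q = q} p<k _ (cycle-edge backward ¬both) with step-off-arc (swap-¬both ¬both)
    ... | inj₁ 1+q≤a = ≢-sym (<⇒≢ (low-step 1+q≤a))
    ... | inj₂ b≤q   = <⇒≢ (high-step b≤q p<k)
    ForestEdge-rank-≢ _ _ (cycle-edge wrap-forward _)  e with trans (sym rank-k-1) (trans e rank-0)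
    ... | ()
    ForestEdge-rank-≢ _ _ (cycle-edge wrap-backward _) e with trans (sym rank-0) (trans e rank-k-1)
    ... | ()
    ForestEdge-rank-≢ _   q<k (chord-out _ p∘ q∉) e = <-irrefl (trans (sym e) (rank-interior p∘)) (rank<k q<k (¬InArc⇒¬Interior q∉))
    ForestEdge-rank-≢ p<k _   (chord-in _ p∉ q∘)  e = <-irrefl (trans e (rank-interior q∘)) (rank<k p<k (¬InArc⇒¬Interior p∉))

    parent : ℕ → Fin n
    parent p with p ≤? a | b ≤? p
    ... | yes _ | _     = walk (p ∸ 1)
    ... | no _  | yes _ = walk (suc p)
    ... | no _  | no _  = mate (walk p)

    private
      parent-low : ∀ {p} → p ≤ a → parent p ≡ walk (p ∸ 1)
      parent-low {p} p≤a with p ≤? a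
      ... | yes _   = refl
      ... | no p≰a = ⊥-elim (p≰a p≤a)

      parent-high : ∀ {p} → b ≤ p → parent p ≡ walk (suc p)
      parent-high {p} b≤p with p ≤? a | b ≤? p
      ... | yes p≤a | _      = ⊥-elim (<-irrefl refl (<-≤-trans a<b (≤-trans b≤p p≤a)))
      ... | no _    | yes _  = refl
      ... | no _    | no b≰p = ⊥-elim (b≰p b≤p)

      parent-interior : ∀ {p} → Interior p → parent p ≡ mate (walk p)
      parent-interior {p} (a<p , p<b) with p ≤? a | b ≤? p
      ... | yes p≤a | _       = ⊥-elim (<-irrefl refl (<-≤-trans a<p p≤a))
      ... | no _    | yes b≤p = ⊥-elim (<-irrefl refl (<-≤-trans p<b b≤p))
      ... | no _    | no _    = refl

    ForestEdge-descends⇒parent : ∀ {p q} → p < k → q < k → ForestEdge p q → rank q < rank p → walk q ≡ parent p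
    ForestEdge-descends⇒parent {p} _ q<k (cycle-edge forward ¬both) down with step-off-arc ¬both
    ... | inj₁ 1+p≤a = ⊥-elim (<-asym down (low-step 1+p≤a))
    ... | inj₂ b≤p   = sym (parent-high b≤p)
    ForestEdge-descends⇒parent {q = q} p<k _ (cycle-edge backward ¬both) down with step-off-arc (swap-¬both ¬both)
    ... | inj₁ 1+q≤a = sym (parent-low 1+q≤a)
    ... | inj₂ b≤q   = ⊥-elim (<-asym down (high-step b≤q p<k))
    ForestEdge-descends⇒parent _ _ (cycle-edge wrap-forward _) _ =
      trans (sym walk-k≡x) (trans (cong walk (sym 1+[k-1]≡k)) (sym (parent-high b≤k-1)))
    ForestEdge-descends⇒parent _ _ (cycle-edge wrap-backward _) down with subst₂ _<_ rank-k-1 rank-0 down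
    ... | ()
    ForestEdge-descends⇒parent _ _ (chord-out Mpq p∘ _) _ = trans (M⇒mate Mpq) (sym (parent-interior p∘))
    ForestEdge-descends⇒parent p<k _ (chord-in _ p∉ q∘) down =
      ⊥-elim (<-asym down (subst (_ <_) (sym (rank-interior q∘)) (rank<k p<k (¬InArc⇒¬Interior p∉))))

    private
      rank-at : ∀ {p} → p < k → rank (pos (walk p)) ≡ rank p
      rank-at p<k = cong rank (pos-walk p<k)

      F-ForestEdge : ∀ {u v} → F u v ≡ true →
        Σ ℕ λ p → Σ ℕ λ q → p < k × q < k × u ≡ walk p × v ≡ walk q × ForestEdge p q
      F-ForestEdge {u} e with S⇒walk (GS-S₁ (F⊆GS u _ e))
      ... | p , p<k , refl with F⇒ForestEdge p<k e
      ... | q , q<k , refl , fe = p , q , p<k , q<k , refl , refl , fe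

    F-acyclic : Acyclic F
    F-acyclic = RankedAcyclicity.no-cycle (λ u v → F u v ≡ true) (λ {u} {v} e → trans (F-sym v u) e)
                                            (rank ∘ pos) rank-≢ lower-unique
      where
      rank-≢ : ∀ {u v} → F u v ≡ true → rank (pos u) ≢ rank (pos v)
      rank-≢ e with F-ForestEdge e
      ... | p , q , p<k , q<k , refl , refl , fe = λ r → ForestEdge-rank-≢ p<k q<k fe (trans (sym (rank-at p<k)) (trans r (rank-at q<k)))
      lower-unique : ∀ {u v v′} → F u v ≡ true → F u v′ ≡ true →
                     rank (pos v) < rank (pos u) → rank (pos v′) < rank (pos u) → v ≡ v′
      lower-unique e e′ down down′ with F-ForestEdge e | F-ForestEdge e′
      ... | p , q , p<k , q<k , refl , refl , fe | p′ , q′ , p′<k , q′<k , walk-p≡p′ , refl , fe′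
        with walk-injective p<k p′<k walk-p≡p′
      ... | refl = trans (ForestEdge-descends⇒parent p<k q<k fe (subst₂ _<_ (rank-at q<k) (rank-at p<k) down))
                         (sym (ForestEdge-descends⇒parent p<k q′<k fe′ (subst₂ _<_ (rank-at q′<k) (rank-at p<k) down′)))

    private
      F-cycle-edge : ∀ {p q} → p < k → q < k → Adjacent p q → ¬ (InArc p × InArc q) → F (walk p) (walk q) ≡ true
      F-cycle-edge {p} {q} p<k q<k adj ¬both
        rewrite H⇒GS (walk-S p) (Adjacent⇒H adj) | H⇒¬M (Adjacent⇒H adj)
        with inArc (walk p) in p∈ | inArc (walk q) in q∈
      ... | true  | true  = ⊥-elim (¬both (inArc⇒InArc p<k p∈ , inArc⇒InArc q<k q∈))
      ... | true  | false = refl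
      ... | false | _     = refl

      F-chord-out : ∀ {p q} → p < k → q < k → M (walk p) (walk q) ≡ true → Interior p → ¬ InArc q →
                    F (walk p) (walk q) ≡ true
      F-chord-out {p} {q} p<k q<k Mpq p∘ q∉
        rewrite GS-intro (walk-S p) (walk-S q) (M⊆G _ _ Mpq) | Mpq
              | InArc⇒inArc p<k (Interior⇒InArc p∘) | ¬InArc⇒inArc q<k q∉ = refl

      reach-x-low : ∀ p → p ≤ a → Reach F (walk p) x
      reach-x-low zero    _     = here
      reach-x-low (suc p) 1+p≤a =
        step (F-cycle-edge (≤-<-trans 1+p≤a a<k) (<-trans (n<1+n p) (≤-<-trans 1+p≤a a<k)) backward
                           (λ (_ , (a≤p , _)) → <-irrefl refl (<-≤-trans 1+p≤a a≤p)))
             (reach-x-low p (≤-trans (n≤1+n p) 1+p≤a))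

      reach-x-high : ∀ j p → p + j ≡ k-1 → b ≤ p → Reach F (walk p) x
      reach-x-high zero p p+0≡k-1 _ rewrite +-identityʳ p | p+0≡k-1 =
        step (F-cycle-edge k-1<k 0<k wrap-forward (λ (_ , (a≤0 , _)) → <-irrefl refl (≤-trans 1≤a a≤0))) here
      reach-x-high (suc j) p p+1+j≡k-1 b≤p =
        step (F-cycle-edge p<k 1+p<k forward (λ (_ , (_ , 1+p≤b)) → <-irrefl refl (≤-trans (s≤s b≤p) 1+p≤b)))
             (reach-x-high j (suc p) (trans (sym (+-suc p j)) p+1+j≡k-1) (≤-trans b≤p (n≤1+n p)))
        where
        1+p<k : suc p < k
        1+p<k = subst (suc p <_) 1+[k-1]≡k (s≤s (subst (suc p ≤_) p+1+j≡k-1 (subst (suc p ≤_) (sym (+-suc p j)) (s≤s (m≤m+n p j)))))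
        p<k : p < k
        p<k = <-trans (n<1+n p) 1+p<k

    reach-x : ∀ {p} → p < k → ¬ Interior p → Reach F (walk p) x
    reach-x {p} p<k p∉ with p ≤? a | b ≤? p
    ... | yes p≤a | _       = reach-x-low p p≤a
    ... | no _    | yes b≤p = reach-x-high (k-1 ∸ p) p (m+[n∸m]≡n (≤-pred (subst (p <_) (sym 1+[k-1]≡k) p<k))) b≤p
    ... | no p≰a  | no b≰p  = ⊥-elim (p∉ (≰⇒> p≰a , ≰⇒> b≰p))

    private
      interior? : ∀ p → Dec (Interior p)
      interior? p = (a <? p) ×-dec (p <? b)

      adjacent-to-interior : ∀ {p q} → Adjacent p q → Interior p → InArc q
      adjacent-to-interior forward       (a<p , p<b) = ≤-trans (<⇒≤ a<p) (n≤1+n _) , p<b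
      adjacent-to-interior backward      (a<p , p<b) = ≤-pred a<p , ≤-trans (n≤1+n _) (<⇒≤ p<b)
      adjacent-to-interior wrap-forward  (_ , k-1<b) = ⊥-elim (<-irrefl refl (<-≤-trans k-1<b b≤k-1))
      adjacent-to-interior wrap-backward (() , _)

      F-isolated-at-interior-boundary : ∀ {p} → p < k → Interior p → S (mate (walk p)) ≡ false → ∀ t → F (walk p) t ≡ false
      F-isolated-at-interior-boundary {p} p<k p∘ ∂p t with F (walk p) t in Fpt
      ... | false = refl
      ... | true with F⇒ForestEdge p<k Fpt
      ... | q , _ , refl , cycle-edge adj ¬both = ⊥-elim (¬both (Interior⇒InArc p∘ , adjacent-to-interior adj p∘))
      ... | q , _ , refl , chord-in _ p∉ _      = ⊥-elim (p∉ (Interior⇒InArc p∘))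
      ... | q , _ , refl , chord-out Mpq _ _ with trans (sym ∂p) (subst (λ z → S z ≡ true) (M⇒mate Mpq) (walk-S q))
      ... | ()

      F-is-GS-at-outer-boundary : ∀ {p} → p < k → ¬ InArc p → S (mate (walk p)) ≡ false → ∀ t → F (walk p) t ≡ GS (walk p) t
      F-is-GS-at-outer-boundary {p} p<k p∉ ∂p t rewrite ¬InArc⇒inArc p<k p∉ with GS (walk p) t in GSpt | M (walk p) t in Mpt
      ... | false | _     = refl
      ... | true  | false = refl
      ... | true  | true with trans (sym ∂p) (subst (λ z → S z ≡ true) (M⇒mate Mpt) (GS-S₂ GSpt))
      ... | ()

      arc-end-not-boundary : ∀ {p} → p < k → InArc p → ¬ Interior p → S (mate (walk p)) ≡ true
      arc-end-not-boundary p<k p∈ p∉ with arc-cases p∈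
      ... | inj₁ refl        = subst (λ z → S z ≡ true) (sym mate-a) (walk-S b)
      ... | inj₂ (inj₁ refl) = subst (λ z → S z ≡ true) (sym mate-b) (walk-S a)
      ... | inj₂ (inj₂ p∘)   = ⊥-elim (p∉ p∘)

    boundary-not-leaf : ∀ {u} → Boundary G S u → ¬ Leaf F u
    boundary-not-leaf ∂u leaf with S⇒walk (proj₁ ∂u)
    ... | p , p<k , refl with boundary⇒mate-outside ∂u | interior? p
    ... | ∂p | yes p∘ with trans (sym leaf) (trans (deg≡count F (walk p)) (count-none n (F-isolated-at-interior-boundary p<k p∘ ∂p)))
    ... | ()
    boundary-not-leaf ∂u leaf | p , p<k , refl | ∂p | no p∉ with inArc? p
    ... | yes p∈ with trans (sym ∂p) (arc-end-not-boundary p<k p∈ p∉)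
    ... | ()
    boundary-not-leaf ∂u leaf | p , p<k , refl | ∂p | no p∉ | no p∉arc
      with trans (sym leaf) (trans (deg≡count F (walk p))
             (trans (count-cong n (F-is-GS-at-outer-boundary p<k p∉arc ∂p)) (trans (sym (deg≡count GS (walk p))) (proj₂ ∂u))))
    ... | ()

    reaches-marked : ∀ v → S v ≡ true → Σ (Fin n) λ u → Reach F v u × ((Boundary G S u × u ≢ x) ⊎ u ≡ x)
    reaches-marked v Sv with S⇒walk Sv
    ... | p , p<k , refl with interior? p
    ... | no p∉ = x , reach-x p<k p∉ , inj₂ refl
    ... | yes p∘ with S (mate (walk p)) ≟ᵇ true
    ... | no ¬Smate = walk p , here , inj₁ (mate-outside⇒boundary (walk-S p) (¬-not ¬Smate) , walk-p≢x)
      where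
      walk-p≢x : walk p ≢ x
      walk-p≢x e = <-irrefl (sym (walk-injective p<k 0<k e)) (≤-<-trans z≤n (proj₁ p∘))
    ... | yes Smate with S⇒walk Smate
    ... | q , q<k , mate≡walk-q =
      x , step (F-chord-out p<k q<k Mpq p∘ q∉) (reach-x q<k (¬InArc⇒¬Interior q∉)) , inj₂ refl
      where
      Mpq : M (walk p) (walk q) ≡ true
      Mpq = subst (λ z → M (walk p) z ≡ true) mate≡walk-q (M-mate (walk p))
      q∉ : ¬ InArc q
      q∉ = interior-mate-outside p∘ q<k Mpq

    decomposition : Decomposition G S (λ _ → ⊥) (λ _ → ⊥) (_≡ x) (λ w → Boundary G S w × w ≢ x)
    decomposition = record
      { F                = F
      ; 𝒞                = 𝒞
      ; Mi               = Mᵢ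
      ; F-sym            = F-sym
      ; 𝒞-sym            = 𝒞-sym
      ; Mi-sym           = Mᵢ-sym
      ; F-sub            = F⊆GS
      ; 𝒞-sub            = 𝒞⊆GS
      ; Mi-sub           = Mᵢ⊆GS
      ; cover            = partition
      ; forest           = F-acyclic
      ; maxdeg2          = 𝒞-maxdeg2
      ; matching         = Mᵢ-matching
      ; cond-i-nonempty  = reaches-marked
      ; cond-i-atmostone = λ _ _ w₁ w₂ _ _ m₁ m₂ l₁ l₂ → trans (marked-end≡x m₁ l₁) (sym (marked-end≡x m₂ l₂))
      ; cond-ii          = λ w → mk⇔ (𝒞-¬IsPathEnd w) ⊥-elim
      }
      where
      marked-end≡x : ∀ {u} → (Boundary G S u × u ≢ x) ⊎ u ≡ x → Leaf F u ⊎ u ≡ x → u ≡ x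
      marked-end≡x (inj₂ u≡x)       _            = u≡x
      marked-end≡x (inj₁ _)         (inj₂ u≡x)   = u≡x
      marked-end≡x (inj₁ (∂u , _)) (inj₁ leaf) = ⊥-elim (boundary-not-leaf ∂u leaf)

  decomposition : (Σ (Fin n) λ v → S v ≡ true × S (mate v) ≡ true) →
                  Decomposition G S (λ _ → ⊥) (λ _ → ⊥) (_≡ x) (λ w → Boundary G S w × w ≢ x)
  decomposition (v , Sv , Smv) with chord⇒ChordOfSpan v Sv Smv
  ... | d₀ , chord₀ with least-witness ChordOfSpan chordOfSpan? d₀ chord₀
  ... | d , (a , 1≤a , a+d<k , Mab) , shortest = ShortestChord.decomposition a d 1≤a a+d<k Mab shortest

cycle-decomposition : ∀ {n} (G M : ERel n) → SymmetricE G → IrreflexiveE G → (∀ v → deg G v ≡ 3) →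
  IsPerfectMatching G M → (c : Fin n) (S : VSet n) → IsComponentOf (G ∖ᴱ M) c S →
  (x : Fin n) → Boundary G S x →
  Decomposition G S (λ _ → ⊥) (λ _ → ⊥) (_≡ x) (λ w → Boundary G S w × w ≢ x)
cycle-decomposition G M G-sym G-irrefl cubic perfect c S component x ∂x
  with Fin.any? (λ v → (S v ≟ᵇ true) ×-dec (S (mate v) ≟ᵇ true))
  where open CubicWithPerfectMatching G M G-sym G-irrefl cubic perfect using (mate)
... | yes chord   = ChordedCycle.decomposition G M G-sym G-irrefl cubic perfect c S component x ∂x chord
... | no no-chord = ChordlessCycle.decomposition G M G-sym G-irrefl cubic perfect c S component x
                      (λ v Sv → ¬-not (λ Smv → no-chord (v , Sv , Smv)))

lemma2 : ∀ {n} (G M : ERel n) → IsStarLike G M →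
           (c : Fin n) (S : VSet n) → IsComponentOf (G ∖ᴱ M) c S →
           (x : Fin n) → Boundary G S x →
           Decomposition G S (λ _ → ⊥) (λ _ → ⊥) (λ w → w ≡ x)
                         (λ w → Boundary G S w × w ≢ x)
lemma2 G M star-like = cycle-decomposition G M G-sym irrefl cubic perfect
  where open IsStarLike star-like renaming (sym to G-sym)
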